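{- The graph $\mathscr L$ labelled by the configuration $\eta\in\Omega$ (the unique configuration of $\Omega$ with $\eta_1=((\top,\top),\mathsf{sea})$) simulates the quadrant $\mathbb N\times\mathbb N$.
   Context: Let $L=\mathbb Z/2\wr\mathbb Z$ be the lamplighter group; write its elements as $(s,n)$ with $s\colon\mathbb Z+\tfrac12\to\mathbb Z/2$ finitely supported and $n\in\mathbb Z$, with product $(r,m)(s,n)=(t,m+n)$, $t_i=r_i+s_{i-m}$; $a=(0,1)$ and $b=(\delta_{1/2},1)$. Let $\mathscr L$ be the Cayley graph of $L$ with respect to $\{a^{\pm1},b^{\pm1}\}$, edges labelled by generators. For $g=(s,n)$ write $s_{>n}$, $s_{<n}$ for the restrictions of $s$ to positions $>n$, $<n$. Let $\mathbb B=\{\bot,\top\}$. $\Omega_\leftarrow\subseteq\mathbb B^L$: all $\eta$ such that for all $g$, with $(\alpha,\beta,\gamma,\delta)=(\eta_g,\eta_{gab^{ -1}},\eta_{ga},\eta_{gb})$, we have $\alpha\vee\beta\Rightarrow\gamma\wedge\delta$ and $\gamma\vee\delta\Rightarrow\alpha\neq\beta$. $\Omega_\rightarrow$ is defined symmetrically with left and right exchanged ($\gamma\vee\delta\Rightarrow\alpha\wedge\beta$ and $\alpha\vee\beta\Rightarrow\gamma\neq\delta$). $\Omega_\leftrightarrow\subseteq\Omega_\leftarrow\times\Omega_\rightarrow$ consists of configurations with $\alpha=(\top,\top)\iff\gamma=(\top,\top)$ for every such tetrahedron. Let $U=\{\nwarrow,\uparrow,\nearrow\}$, $D=\{\swarrow,\downarrow,\searrow\}$,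 $A=U\cup\{\mathsf{sea}\}\cup D$, where $\mathsf{sea}$ is the "sea level" symbol (drawn as the Aquarius sign in the paper). Let $\phi(U)=1$, $\phi(\mathsf{sea})=0$, $\phi(D)=-1$. $\Omega_{\mathsf{sea}}\subseteq A^L$ consists of $\eta$ such that every tetrahedron $(\alpha,\beta,\gamma,\delta)=(\eta_g,\eta_{gab^{ -1}},\eta_{ga},\eta_{gb})$ satisfies: $\phi(\alpha)=\phi(\beta)$, $\phi(\gamma)=\phi(\delta)$; $\phi(\gamma)-\phi(\alpha)\in\{0,1\}$; $\alpha=\mathsf{sea}\Rightarrow\{\gamma,\delta\}=\{\nwarrow,\nearrow\}$; $\gamma=\mathsf{sea}\Rightarrow\{\alpha,\beta\}=\{\swarrow,\searrow\}$; $\alpha\in U\Rightarrow\beta=\alpha\wedge\{\gamma,\delta\}=\{\uparrow,\alpha\}$; $\gamma\in D\Rightarrow\delta=\gamma\wedge\{\alpha,\beta\}=\{\downarrow,\gamma\}$. $\Omega\subseteq\Omega_\leftrightarrow\times\Omega_{\mathsf{sea}}$ consists of configurations whose tetrahedra additionally satisfy: $\alpha=((\top,*),\mathsf{sea})\Rightarrow\gamma=(*,\nwarrow)\wedge\delta=(*,\nearrow)$; $\alpha=((\top,*),\nwarrow)\Rightarrow\gamma=(*,\nwarrow)$; $\alpha=((\top,*),\nearrow)\Rightarrow\delta=(*,\nearrow)$; $\gamma=((*,\top),\mathsf{sea})\Rightarrow\alpha=(*,\swarrow)\wedge\beta=(*,\searrow)$; $\gamma=((*,\top),\swarrow)\Rightarrow\alpha=(*,\swarrow)$;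 $\gamma=((*,\top),\searrow)\Rightarrow\beta=(*,\searrow)$. There is a unique $\eta\in\Omega$ with $\eta_1=((\top,\top),\mathsf{sea})$; $\mathscr L$ is vertex-labelled by it. Simulation: for graphs $\mathscr A,\mathscr B$, $\mathscr B^*$ is the path subdivision (vertices $V(\mathscr B)\sqcup E(\mathscr B)$, edges $(i,e,j)\in\{0,1\}\times E(\mathscr B)\times\{0,1\}$ with $(0,e,0)$ from $e^-$ to $e^+$, $(0,e,1)$ from $e^-$ to $e$, $(1,e,1)$ a loop at $e$, $(1,e,0)$ from $e$ to $e^+$). A simulator is a graph $\mathscr S$ with labellings $\mathscr S\to\mathscr A$ and $\mathscr S\to\mathscr B^*$; for an $\mathscr A$-labelled $\mathscr G$, $\mathscr G\rtimes\mathscr S$ is obtained from the fibre product $\mathscr G\times_{\mathscr A}\mathscr S$ by keeping vertices with label in $V(\mathscr B)$ and replacing each path labelled $(0,c,1),(1,c,1),\dots,(1,c,1),(1,c,0)$ (or a single edge $(0,c,0)$) by an edge labelled $c$. $\mathscr G$ simulates $\mathscr H$ if $\mathscr H\cong\mathscr G\rtimes\mathscr S$ for some finite simulator $\mathscr S$. The quadrant $\mathbb N\times\mathbb N$ is the full subgraph of the Cayley graph of $\mathbb Z^2$ (generators $\rightarrow,\leftarrow,\uparrow,\downarrow$) on $\mathbb N^2$, vertex-labelled by which directions are available. -}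

module Defs where

open import Data.Nat using (ℕ; zero; suc; _+_; _*_; _∸_; _^_; ⌊_/2⌋; _≡ᵇ_)
open import Data.Integer using (ℤ; +_; -[1+_]; _≟_) renaming (_+_ to _+ℤ_; _-_ to _-ℤ_)
open import Data.Bool using (Bool; true; false; _∧_; _∨_; not; _xor_; if_then_else_; T)
open import Data.Fin using (Fin)
open import Data.Product using (Σ; _×_; _,_; proj₁; proj₂)
open import Data.Sum using (_⊎_; inj₁; inj₂)
open import Relation.Nullary.Decidable using (does)
open import Relation.Binary.PropositionalEquality using (_≡_; refl; sym; trans; cong)
open import Function.Bundles using (_↔_; Inverse)

record Graph : Set₁ where
  field
    V E : Set
    src tgt : E → V

record Hom (G H : Graph) : Set where
  field
    vmap : Graph.V G → Graph.V H
    emap : Graph.E G → Graph.E H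
    src-comm : ∀ e → vmap (Graph.src G e) ≡ Graph.src H (emap e)
    tgt-comm : ∀ e → vmap (Graph.tgt G e) ≡ Graph.tgt H (emap e)

record LGraph (A : Graph) : Set₁ where
  field
    graph : Graph
    lab   : Hom graph A

-- label graph for graphs whose vertices are labelled in VL and edges in EL
Full : Set → Set → Graph
Full VL EL = record { V = VL ; E = VL × EL × VL ; src = proj₁ ; tgt = λ e → proj₂ (proj₂ e) }

-- path subdivision 𝓑* ; false = 0, true = 1
subSrc : (B : Graph) → Bool × Graph.E B × Bool → Graph.V B ⊎ Graph.E B
subSrc B (false , e , _) = inj₁ (Graph.src B e)
subSrc B (true  , e , _) = inj₂ e

subTgt : (B : Graph) → Bool × Graph.E B × Bool → Graph.V B ⊎ Graph.E B
subTgt B (_ , e , false) = inj₁ (Graph.tgt B e)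
subTgt B (_ , e , true)  = inj₂ e

Sub : Graph → Graph
Sub B = record { V = Graph.V B ⊎ Graph.E B ; E = Bool × Graph.E B × Bool
               ; src = subSrc B ; tgt = subTgt B }

record FinSimulator (A B : Graph) : Set where
  field
    nV nE : ℕ
    ssrc stgt : Fin nE → Fin nV
  sgraph : Graph
  sgraph = record { V = Fin nV ; E = Fin nE ; src = ssrc ; tgt = stgt }
  field
    toA : Hom sgraph A
    toB : Hom sgraph (Sub B)

module Simulation {A B : Graph} (G : LGraph A) (S : FinSimulator A B) where
  private
    module G = Graph (LGraph.graph G)
    module ℓ = Hom (LGraph.lab G)
    module S = FinSimulator S
    module SA = Hom S.toA
    module SB = Hom S.toB

  FV : Set
  FV = Σ (G.V × Fin S.nV) (λ p → ℓ.vmap (proj₁ p) ≡ SA.vmap (proj₂ p))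

  FE : Set
  FE = Σ (G.E × Fin S.nE) (λ p → ℓ.emap (proj₁ p) ≡ SA.emap (proj₂ p))

  fsrc : FE → FV
  fsrc ((e , f) , eq) = (G.src e , S.ssrc f) ,
    trans (ℓ.src-comm e) (trans (cong (Graph.src A) eq) (sym (SA.src-comm f)))

  ftgt : FE → FV
  ftgt ((e , f) , eq) = (G.tgt e , S.stgt f) ,
    trans (ℓ.tgt-comm e) (trans (cong (Graph.tgt A) eq) (sym (SA.tgt-comm f)))

  labV : FV → Graph.V B ⊎ Graph.E B
  labV x = SB.vmap (proj₂ (proj₁ x))

  labE : FE → Bool × Graph.E B × Bool
  labE p = SB.emap (proj₂ (proj₁ p))

  SimV : Set
  SimV = Σ FV (λ x → Σ (Graph.V B) (λ b → labV x ≡ inj₁ b))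

  -- the part (1,c,1)…(1,c,1)(1,c,0) of a path, starting at a given vertex
  data Tail (c : Graph.E B) : FV → Set where
    stop : (p : FE) → labE p ≡ (true , c , false) → Tail c (fsrc p)
    loop : (p : FE) → labE p ≡ (true , c , true) → Tail c (ftgt p) → Tail c (fsrc p)

  tailEnd : {c : Graph.E B} {x : FV} → Tail c x → SimV
  tailEnd {c} (stop p eq) = ftgt p , Graph.tgt B c ,
    trans (SB.tgt-comm (proj₂ (proj₁ p))) (cong (subTgt B) eq)
  tailEnd (loop p eq t) = tailEnd t

  -- edges of 𝒢 ⋊ 𝒮 : paths labelled (0,c,0), or (0,c,1)(1,c,1)^k(1,c,0)
  data SimE : Set where
    direct : (c : Graph.E B) (p : FE) → labE p ≡ (false , c , false) → SimE
    via    : (c : Graph.E B) (p : FE) → labE p ≡ (false , c , true) → Tail c (ftgt p) → SimE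

  simLabE : SimE → Graph.E B
  simLabE (direct c _ _) = c
  simLabE (via c _ _ _) = c

  simSrc : SimE → SimV
  simSrc (direct c p eq) = fsrc p , Graph.src B c ,
    trans (SB.src-comm (proj₂ (proj₁ p))) (cong (subSrc B) eq)
  simSrc (via c p eq _) = fsrc p , Graph.src B c ,
    trans (SB.src-comm (proj₂ (proj₁ p))) (cong (subSrc B) eq)

  simTgt : SimE → SimV
  simTgt (direct c p eq) = ftgt p , Graph.tgt B c ,
    trans (SB.tgt-comm (proj₂ (proj₁ p))) (cong (subTgt B) eq)
  simTgt (via c p eq t) = tailEnd t

  simGraph : Graph
  simGraph = record { V = SimV ; E = SimE ; src = simSrc ; tgt = simTgt }

  simTgt-comm : ∀ e → proj₁ (proj₂ (simTgt e)) ≡ Graph.tgt B (simLabE e)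
  simTgt-comm (direct c p eq) = refl
  simTgt-comm (via c p eq t) = go t
    where
    go : ∀ {x} → (t : Tail c x) → proj₁ (proj₂ (tailEnd t)) ≡ Graph.tgt B c
    go (stop p eq) = refl
    go (loop p eq t) = go t

  simSrc-comm : ∀ e → proj₁ (proj₂ (simSrc e)) ≡ Graph.src B (simLabE e)
  simSrc-comm (direct c p eq) = refl
  simSrc-comm (via c p eq t) = refl

  ⋊ : LGraph B
  ⋊ = record
    { graph = simGraph
    ; lab = record { vmap = λ v → proj₁ (proj₂ v) ; emap = simLabE
                   ; src-comm = simSrc-comm ; tgt-comm = simTgt-comm } }

_⋊_ : {A B : Graph} → LGraph A → FinSimulator A B → LGraph B
G ⋊ S = Simulation.⋊ G S

record LIso {B : Graph} (H K : LGraph B) : Set where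
  private
    module H = Graph (LGraph.graph H)
    module K = Graph (LGraph.graph K)
    module ℓH = Hom (LGraph.lab H)
    module ℓK = Hom (LGraph.lab K)
  field
    vbij : H.V ↔ K.V
    ebij : H.E ↔ K.E
  vto = Inverse.to vbij
  eto = Inverse.to ebij
  field
    src-pres : ∀ e → vto (H.src e) ≡ K.src (eto e)
    tgt-pres : ∀ e → vto (H.tgt e) ≡ K.tgt (eto e)
    vlab-pres : ∀ v → ℓH.vmap v ≡ ℓK.vmap (vto v)
    elab-pres : ∀ e → ℓH.emap e ≡ ℓK.emap (eto e)

Simulates : {A B : Graph} → LGraph A → LGraph B → Set
Simulates {A} {B} G H = Σ (FinSimulator A B) (λ S → LIso H (G ⋊ S))

-- A finitely supported s : ℤ+½ → ℤ/2 is encoded (bijectively) by a natural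
-- number: lamp at position i+½ (i : ℤ) is bit number (zig i) of the code.
zig : ℤ → ℕ
zig (+ n) = 2 * n
zig -[1+ n ] = suc (2 * n)

isOdd : ℕ → Bool
isOdd zero = false
isOdd (suc n) = not (isOdd n)

testBit : ℕ → ℕ → Bool
testBit n zero = isOdd n
testBit n (suc k) = testBit ⌊ n /2⌋ k

flipBit : ℕ → ℕ → ℕ
flipBit n k = if testBit n k then n ∸ 2 ^ k else n + 2 ^ k

toggle : ℕ → ℤ → ℕ
toggle s i = flipBit s (zig i)

Lamp : Set
Lamp = ℕ × ℤ

one : Lamp
one = 0 , + 0

data Gen : Set where
  a a⁻¹ b b⁻¹ : Gen

-- right multiplication by a generator: a = (0,1), b = (δ_{1/2},1)
_·_ : Lamp → Gen → Lamp
(s , n) · a   = s , n +ℤ + 1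
(s , n) · a⁻¹ = s , n -ℤ + 1
(s , n) · b   = toggle s n , n +ℤ + 1
(s , n) · b⁻¹ = toggle s (n -ℤ + 1) , n -ℤ + 1

infixl 7 _·_

data Arrow : Set where
  nw up ne sea sw down se : Arrow

codeA : Arrow → ℕ
codeA nw = 0
codeA up = 1
codeA ne = 2
codeA sea = 3
codeA sw = 4
codeA down = 5
codeA se = 6

_==_ : Arrow → Arrow → Bool
x == y = codeA x ≡ᵇ codeA y

isU : Arrow → Bool
isU nw = true
isU up = true
isU ne = true
isU _  = false

isD : Arrow → Bool
isD sw = true
isD down = true
isD se = true
isD _ = false

φ : Arrow → ℤ
φ x = if isU x then + 1 else (if isD x then -[1+ 0 ] else + 0)

_=ℤ_ : ℤ → ℤ → Bool
x =ℤ y = does (x ≟ y)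

infix 4 _=ℤ_ _==_

_⇒ᵇ_ : Bool → Bool → Bool
x ⇒ᵇ y = not x ∨ y

_⇔ᵇ_ : Bool → Bool → Bool
x ⇔ᵇ y = not (x xor y)

infixr 4 _⇒ᵇ_

_∈₂_,_ : Arrow → Arrow → Arrow → Bool
x ∈₂ y , z = (x == y) ∨ (x == z)

setEq : Arrow → Arrow → Arrow → Arrow → Bool
setEq x y z w = (x ∈₂ z , w) ∧ (y ∈₂ z , w) ∧ (z ∈₂ x , y) ∧ (w ∈₂ x , y)

leftRule : Bool → Bool → Bool → Bool → Bool
leftRule α β γ δ = ((α ∨ β) ⇒ᵇ (γ ∧ δ)) ∧ ((γ ∨ δ) ⇒ᵇ (α xor β))

rightRule : Bool → Bool → Bool → Bool → Bool
rightRule α β γ δ = ((γ ∨ δ) ⇒ᵇ (α ∧ β)) ∧ ((α ∨ β) ⇒ᵇ (γ xor δ))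

lrRule : Bool × Bool → Bool × Bool → Bool × Bool → Bool × Bool → Bool
lrRule (α₁ , α₂) (β₁ , β₂) (γ₁ , γ₂) (δ₁ , δ₂) =
  leftRule α₁ β₁ γ₁ δ₁ ∧ rightRule α₂ β₂ γ₂ δ₂ ∧ ((α₁ ∧ α₂) ⇔ᵇ (γ₁ ∧ γ₂))

seaRule : Arrow → Arrow → Arrow → Arrow → Bool
seaRule α β γ δ =
  (φ α =ℤ φ β) ∧ (φ γ =ℤ φ δ)
  ∧ (((φ γ -ℤ φ α) =ℤ + 0) ∨ ((φ γ -ℤ φ α) =ℤ + 1))
  ∧ ((α == sea) ⇒ᵇ setEq γ δ nw ne)
  ∧ ((γ == sea) ⇒ᵇ setEq α β sw se)
  ∧ (isU α ⇒ᵇ ((β == α) ∧ setEq γ δ up α))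
  ∧ (isD γ ⇒ᵇ ((δ == γ) ∧ setEq α β down γ))

Λ : Set
Λ = (Bool × Bool) × Arrow

coupleRule : Λ → Λ → Λ → Λ → Bool
coupleRule ((α₁ , α₂) , α) (_ , β) ((γ₁ , γ₂) , γ) (_ , δ) =
  ((α₁ ∧ (α == sea)) ⇒ᵇ ((γ == nw) ∧ (δ == ne)))
  ∧ ((α₁ ∧ (α == nw)) ⇒ᵇ (γ == nw))
  ∧ ((α₁ ∧ (α == ne)) ⇒ᵇ (δ == ne))
  ∧ ((γ₂ ∧ (γ == sea)) ⇒ᵇ ((α == sw) ∧ (β == se)))
  ∧ ((γ₂ ∧ (γ == sw)) ⇒ᵇ (α == sw))
  ∧ ((γ₂ ∧ (γ == se)) ⇒ᵇ (β == se))

tetRule : Λ → Λ → Λ → Λ → Bool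
tetRule α β γ δ =
  lrRule (proj₁ α) (proj₁ β) (proj₁ γ) (proj₁ δ)
  ∧ seaRule (proj₂ α) (proj₂ β) (proj₂ γ) (proj₂ δ)
  ∧ coupleRule α β γ δ

InΩ : (Lamp → Λ) → Set
InΩ η = ∀ g → T (tetRule (η g) (η (g · a · b⁻¹)) (η (g · a)) (η (g · b)))

LampGraph : Graph
LampGraph = record { V = Lamp ; E = Lamp × Gen ; src = proj₁ ; tgt = λ e → proj₁ e · proj₂ e }

cayley : (η : Lamp → Λ) → LGraph (Full Λ Gen)
cayley η = record
  { graph = LampGraph
  ; lab = record { vmap = η ; emap = λ e → η (proj₁ e) , proj₂ e , η (proj₁ e · proj₂ e)
                 ; src-comm = λ _ → refl ; tgt-comm = λ _ → refl } }

data Dir : Set where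
  goR goL goU goD : Dir

-- available directions (→ , ← , ↑ , ↓)
QLab : Set
QLab = Bool × Bool × Bool × Bool

pos? : ℕ → Bool
pos? zero = false
pos? (suc _) = true

qlab : ℕ × ℕ → QLab
qlab (x , y) = true , pos? x , true , pos? y

-- edges: (x , y , d) is the d-edge whose endpoints are (x,y) and its
-- neighbour in direction goR / goU; goL, goD go back
qsrc : ℕ × ℕ × Dir → ℕ × ℕ
qsrc (x , y , goR) = x , y
qsrc (x , y , goL) = suc x , y
qsrc (x , y , goU) = x , y
qsrc (x , y , goD) = x , suc y

qtgt : ℕ × ℕ × Dir → ℕ × ℕ
qtgt (x , y , goR) = suc x , y
qtgt (x , y , goL) = x , y
qtgt (x , y , goU) = x , suc y
qtgt (x , y , goD) = x , y

QGraph : Graph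
QGraph = record { V = ℕ × ℕ ; E = ℕ × ℕ × Dir ; src = qsrc ; tgt = qtgt }

Quadrant : LGraph (Full QLab Dir)
Quadrant = record
  { graph = QGraph
  ; lab = record { vmap = qlab ; emap = λ e → qlab (qsrc e) , proj₂ (proj₂ e) , qlab (qtgt e)
                 ; src-comm = λ _ → refl ; tgt-comm = λ _ → refl } }

-- Write an element of L at level n ≥ 0 as a pair (u , w) of numbers, u coding
-- the lamps right of the origin and w those to the left.  Starting from η 1,
-- the local rules force η completely: its ←-mark is ⊤ exactly when u < 2ⁿ,
-- and its arrow is sea at level 0 and, above, nw, ne or up according as the n
-- lowest lamps of u are all off, all on, or mixed; levels below 0 mirror this
-- with the →-mark and sw, se, down.  Hence the elements at sea level carry
-- labels ((x = 0 , y = 0) , sea) and are in bijection with ℕ × ℕ.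
--
-- The quadrant edge (x , y) → (x + 1 , y) is binary increment of x: climb with
-- a while the arrow reads ne (the trailing ones of x), flip the first zero with
-- b, step back with a⁻¹ and descend with b⁻¹, clearing the ones.  The arrows
-- tell a finite automaton when to turn, so these walks are the edges of 𝓛 ⋊ 𝒮
-- for a finite simulator 𝒮; decrements and the y direction (below sea level)
-- are symmetric.  Conversely every walk of 𝒮 through 𝓛 is forced, because a
-- and b never both lead to an nw/ne arrow, so there are no other edges.

module Submission where

open import Defs
open import Data.Bool using (true)
open import Data.Product using (_,_)
open import Relation.Binary.PropositionalEquality using (_≡_)

module Binary where

  open import Data.Nat using (ℕ; zero; suc; _+_; _∸_; _^_; ⌊_/2⌋; _≤_; _<_; z≤n; s≤s)
  open import Data.Nat.Properties
  open import Data.Bool using (Bool; true; false; _∧_; not; _xor_; if_then_else_)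
  open import Data.Bool.Properties using (not-involutive; not-¬; xor-assoc; xor-same; xor-identityʳ; ∧-comm; ∧-assoc)
  open import Data.Product using (Σ; _×_; _,_; proj₁; proj₂)
  open import Data.Sum using (_⊎_; inj₁; inj₂; [_,_]′)
  open import Data.Empty using (⊥; ⊥-elim)
  open import Relation.Nullary using (yes; no)
  open import Relation.Binary.Definitions using (tri<; tri≈; tri>)
  open import Relation.Binary.PropositionalEquality
  open import Algebra.Properties.CommutativeSemigroup +-commutativeSemigroup using (interchange)

  pushBit : Bool → ℕ → ℕ
  pushBit false h = h + h
  pushBit true h = suc (h + h)

  isOdd-double : ∀ h → isOdd (h + h) ≡ false
  isOdd-double zero = refl
  isOdd-double (suc h) rewrite +-suc h h = trans (not-involutive (isOdd (h + h))) (isOdd-double h)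

  isOdd-pushBit : ∀ bq h → isOdd (pushBit bq h) ≡ bq
  isOdd-pushBit false h = isOdd-double h
  isOdd-pushBit true h = cong not (isOdd-double h)

  half-double : ∀ h → ⌊ h + h /2⌋ ≡ h
  half-double zero = refl
  half-double (suc h) rewrite +-suc h h = cong suc (half-double h)

  half-pushBit : ∀ bq h → ⌊ pushBit bq h /2⌋ ≡ h
  half-pushBit false h = half-double h
  half-pushBit true zero = refl
  half-pushBit true (suc h) rewrite +-suc h h = cong suc (half-pushBit true h)

  pushBit-split : ∀ n → pushBit (isOdd n) ⌊ n /2⌋ ≡ n
  pushBit-split zero = refl
  pushBit-split (suc zero) = refl
  pushBit-split (suc (suc n)) with isOdd n | pushBit-split n
  ... | false | e = cong suc (trans (+-suc ⌊ n /2⌋ ⌊ n /2⌋) (cong suc e))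
  ... | true | e = trans (cong suc (cong suc (+-suc ⌊ n /2⌋ ⌊ n /2⌋))) (cong (λ z → suc (suc z)) e)

  testBit-pushBit-suc : ∀ bq h k → testBit (pushBit bq h) (suc k) ≡ testBit h k
  testBit-pushBit-suc bq h k = cong (λ z → testBit z k) (half-pushBit bq h)

  Fits : ℕ → ℕ → Set
  Fits j u = ∀ k → j ≤ k → testBit u k ≡ false

  LowBits : Bool → ℕ → ℕ → Set
  LowBits v u t = ∀ k → k < t → testBit u k ≡ v

  testBit-0 : ∀ k → testBit 0 k ≡ false
  testBit-0 zero = refl
  testBit-0 (suc k) = testBit-0 k

  half-≤ : ∀ f n → n ≤ suc f → ⌊ n /2⌋ ≤ f
  half-≤ f zero _ = z≤n
  half-≤ f (suc n) le = ≤-pred (≤-trans (⌊n/2⌋<n n) le)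

  bits-false⇒≡0-bounded : ∀ f n → n ≤ f → (∀ k → testBit n k ≡ false) → n ≡ 0
  bits-false⇒≡0-bounded zero n le _ = n≤0⇒n≡0 le
  bits-false⇒≡0-bounded (suc f) n le h =
    trans (sym (pushBit-split n))
      (trans (cong₂ pushBit (h 0) (bits-false⇒≡0-bounded f ⌊ n /2⌋ (half-≤ f n le) (λ k → h (suc k)))) refl)

  bits-false⇒≡0 : ∀ n → (∀ k → testBit n k ≡ false) → n ≡ 0
  bits-false⇒≡0 n = bits-false⇒≡0-bounded n n ≤-refl

  testBit-ext-bounded : ∀ f m n → m ≤ f → (∀ k → testBit m k ≡ testBit n k) → m ≡ n
  testBit-ext-bounded zero m n le h rewrite n≤0⇒n≡0 le = sym (bits-false⇒≡0 n (λ k → trans (sym (h k)) (testBit-0 k)))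
  testBit-ext-bounded (suc f) m n le h =
    trans (sym (pushBit-split m))
      (trans (cong₂ pushBit (h 0) (testBit-ext-bounded f ⌊ m /2⌋ ⌊ n /2⌋ (half-≤ f m le) (λ k → h (suc k)))) (pushBit-split n))

  testBit-ext : ∀ m n → (∀ k → testBit m k ≡ testBit n k) → m ≡ n
  testBit-ext m n = testBit-ext-bounded m m n ≤-refl

  testBit-≥ : ∀ k n → n ≤ k → testBit n k ≡ false
  testBit-≥ zero n le rewrite n≤0⇒n≡0 le = refl
  testBit-≥ (suc k) n le = testBit-≥ k ⌊ n /2⌋ (half-≤ k n le)

  testBit⇒2^≤ : ∀ k h → testBit h k ≡ true → 2 ^ k ≤ h
  testBit⇒2^≤ zero zero ()
  testBit⇒2^≤ zero (suc h) _ = s≤s z≤n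
  testBit⇒2^≤ (suc k) h e =
    ≤-trans (+-mono-≤ (testBit⇒2^≤ k ⌊ h /2⌋ e) (+-mono-≤ (testBit⇒2^≤ k ⌊ h /2⌋ e) (≤-refl {0})))
      (≤-trans (mkge (isOdd h) ⌊ h /2⌋) (≤-reflexive (pushBit-split h)))
    where
    mkge : ∀ bq x → x + (x + 0) ≤ pushBit bq x
    mkge false x = ≤-reflexive (cong (x +_) (+-identityʳ x))
    mkge true x = m≤n⇒m≤1+n (≤-reflexive (cong (x +_) (+-identityʳ x)))

  pushBit-+-double : ∀ bq h p → pushBit bq h + (p + (p + 0)) ≡ pushBit bq (h + p)
  pushBit-+-double false h p rewrite +-identityʳ p = interchange h h p p
  pushBit-+-double true h p = cong suc (pushBit-+-double false h p)

  pushBit-∸-double : ∀ bq h p → p ≤ h → pushBit bq h ∸ (p + (p + 0)) ≡ pushBit bq (h ∸ p)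
  pushBit-∸-double bq h p le = begin
      pushBit bq h ∸ (p + (p + 0))               ≡⟨ cong (λ z → pushBit bq z ∸ (p + (p + 0))) (sym (m+[n∸m]≡n le)) ⟩
      pushBit bq (p + (h ∸ p)) ∸ (p + (p + 0))   ≡⟨ cong (_∸ (p + (p + 0))) (cong (pushBit bq) (+-comm p (h ∸ p))) ⟩
      pushBit bq ((h ∸ p) + p) ∸ (p + (p + 0))   ≡⟨ cong (_∸ (p + (p + 0))) (sym (pushBit-+-double bq (h ∸ p) p)) ⟩
      pushBit bq (h ∸ p) + (p + (p + 0)) ∸ (p + (p + 0)) ≡⟨ m+n∸n≡m (pushBit bq (h ∸ p)) (p + (p + 0)) ⟩
      pushBit bq (h ∸ p) ∎
    where open ≡-Reasoning

  flipBit-pushBit-suc : ∀ bq h k → flipBit (pushBit bq h) (suc k) ≡ pushBit bq (flipBit h k)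
  flipBit-pushBit-suc bq h k = trans (cong (λ t → if t then pushBit bq h ∸ (2 ^ suc k) else pushBit bq h + (2 ^ suc k)) (testBit-pushBit-suc bq h k)) helper
    where
    helper : (if testBit h k then pushBit bq h ∸ (2 ^ suc k) else pushBit bq h + (2 ^ suc k)) ≡ pushBit bq (flipBit h k)
    helper with testBit h k in eq
    ... | true = pushBit-∸-double bq h (2 ^ k) (testBit⇒2^≤ k h eq)
    ... | false = pushBit-+-double bq h (2 ^ k)

  flipBit-pushBit-0 : ∀ bq h → flipBit (pushBit bq h) 0 ≡ pushBit (not bq) h
  flipBit-pushBit-0 false h rewrite isOdd-double h = +-comm (h + h) 1
  flipBit-pushBit-0 true h rewrite isOdd-double h = refl

  testBit-flipBit-same : ∀ k n → testBit (flipBit n k) k ≡ not (testBit n k)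
  testBit-flipBit-same zero n rewrite sym (pushBit-split n) | flipBit-pushBit-0 (isOdd n) ⌊ n /2⌋
    | isOdd-pushBit (not (isOdd n)) ⌊ n /2⌋ | isOdd-pushBit (isOdd n) ⌊ n /2⌋ = refl
  testBit-flipBit-same (suc k) n rewrite sym (pushBit-split n) | flipBit-pushBit-suc (isOdd n) ⌊ n /2⌋ k
    | testBit-pushBit-suc (isOdd n) (flipBit ⌊ n /2⌋ k) k | testBit-pushBit-suc (isOdd n) ⌊ n /2⌋ k = testBit-flipBit-same k ⌊ n /2⌋

  testBit-flipBit-other : ∀ k j n → k ≢ j → testBit (flipBit n k) j ≡ testBit n j
  testBit-flipBit-other zero zero n nq = ⊥-elim (nq refl)
  testBit-flipBit-other zero (suc j) n nq rewrite sym (pushBit-split n) | flipBit-pushBit-0 (isOdd n) ⌊ n /2⌋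
    | testBit-pushBit-suc (not (isOdd n)) ⌊ n /2⌋ j | testBit-pushBit-suc (isOdd n) ⌊ n /2⌋ j = refl
  testBit-flipBit-other (suc k) zero n nq rewrite sym (pushBit-split n) | flipBit-pushBit-suc (isOdd n) ⌊ n /2⌋ k
    | isOdd-pushBit (isOdd n) (flipBit ⌊ n /2⌋ k) | isOdd-pushBit (isOdd n) ⌊ n /2⌋ = refl
  testBit-flipBit-other (suc k) (suc j) n nq rewrite sym (pushBit-split n) | flipBit-pushBit-suc (isOdd n) ⌊ n /2⌋ k
    | testBit-pushBit-suc (isOdd n) (flipBit ⌊ n /2⌋ k) j | testBit-pushBit-suc (isOdd n) ⌊ n /2⌋ j =
    testBit-flipBit-other k j ⌊ n /2⌋ (λ e → nq (cong suc e))

  eqB : Bool → Bool → Bool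
  eqB true true = true
  eqB false false = true
  eqB _ _ = false

  lowBits : Bool → ℕ → ℕ → Bool
  lowBits v x zero = true
  lowBits v x (suc k) = eqB (isOdd x) v ∧ lowBits v ⌊ x /2⌋ k

  xor-true : ∀ x → x xor true ≡ not x
  xor-true true = refl
  xor-true false = refl

  testBit-suc : ∀ k x → testBit (suc x) k ≡ testBit x k xor lowBits true x k
  testBit-suc zero x = sym (xor-true (isOdd x))
  testBit-suc (suc k) x = subst P (pushBit-split x) (go (isOdd x) ⌊ x /2⌋)
    where
    P : ℕ → Set
    P x = testBit (suc x) (suc k) ≡ testBit x (suc k) xor lowBits true x (suc k)
    go : ∀ c h → P (pushBit c h)
    go false h rewrite half-pushBit true h | half-double h | isOdd-double h = sym (xor-identityʳ (testBit h k))
    go true h rewrite half-double h | half-pushBit true h | isOdd-pushBit true h = testBit-suc k h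

  lowBits-false-suc : ∀ k x → lowBits false (suc x) k ≡ lowBits true x k
  lowBits-false-suc zero x = refl
  lowBits-false-suc (suc k) x = subst P (pushBit-split x) (go (isOdd x) ⌊ x /2⌋)
    where
    P : ℕ → Set
    P x = lowBits false (suc x) (suc k) ≡ lowBits true x (suc k)
    go : ∀ c h → P (pushBit c h)
    go false h rewrite isOdd-double h = refl
    go true h rewrite half-double h | half-pushBit true h | isOdd-double h = lowBits-false-suc k h

  xor-cancelʳ : ∀ x y → (x xor y) xor y ≡ x
  xor-cancelʳ x y = trans (xor-assoc x y y) (trans (cong (x xor_) (xor-same y)) (xor-identityʳ x))

  testBit-pred : ∀ k x → testBit x k ≡ testBit (suc x) k xor lowBits false (suc x) k
  testBit-pred k x rewrite lowBits-false-suc k x | testBit-suc k x = sym (xor-cancelʳ (testBit x k) (lowBits true x k))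

  eqB-sound : ∀ {x y} → eqB x y ≡ true → x ≡ y
  eqB-sound {true} {true} _ = refl
  eqB-sound {false} {false} _ = refl

  lowBits⇒testBit : ∀ v x k → lowBits v x k ≡ true → LowBits v x k
  lowBits⇒testBit v x (suc k) e i lt with eqB (isOdd x) v in same
  lowBits⇒testBit v x (suc k) e zero _ | true = eqB-sound same
  lowBits⇒testBit v x (suc k) e (suc i) (s≤s lt) | true = lowBits⇒testBit v ⌊ x /2⌋ k e i lt
  lowBits⇒testBit v x (suc k) () i lt | false

  eqB-refl : ∀ v → eqB v v ≡ true
  eqB-refl true = refl
  eqB-refl false = refl

  testBit⇒lowBits : ∀ v x k → LowBits v x k → lowBits v x k ≡ true
  testBit⇒lowBits v x zero h = refl
  testBit⇒lowBits v x (suc k) h rewrite h 0 (s≤s z≤n) | eqB-refl v = testBit⇒lowBits v ⌊ x /2⌋ k (λ i lt → h (suc i) (s≤s lt))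

  fromBits : (ℕ → Bool) → ℕ → ℕ
  fromBits f zero = 0
  fromBits f (suc K) = pushBit (f 0) (fromBits (λ k → f (suc k)) K)

  testBit-fromBits : ∀ K f → (∀ k → K ≤ k → f k ≡ false) → ∀ k → testBit (fromBits f K) k ≡ f k
  testBit-fromBits zero f h k = trans (testBit-0 k) (sym (h k z≤n))
  testBit-fromBits (suc K) f h zero = isOdd-pushBit (f 0) _
  testBit-fromBits (suc K) f h (suc k) =
    trans (testBit-pushBit-suc (f 0) _ k) (testBit-fromBits K (λ k → f (suc k)) (λ k le → h (suc k) (s≤s le)) k)

  interleaveBit : ℕ → ℕ → ℕ → Bool
  interleaveBit x y zero = isOdd x
  interleaveBit x y (suc k) = interleaveBit y ⌊ x /2⌋ k

  interleaveBit-even : ∀ i x y → interleaveBit x y (i + i) ≡ testBit x i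
  interleaveBit-even zero x y = refl
  interleaveBit-even (suc i) x y rewrite +-suc i i = interleaveBit-even i ⌊ x /2⌋ ⌊ y /2⌋

  interleaveBit-odd : ∀ i x y → interleaveBit x y (suc (i + i)) ≡ testBit y i
  interleaveBit-odd i x y = interleaveBit-even i y ⌊ x /2⌋

  double-cancel-≤ : ∀ m n → m + m ≤ n + n → m ≤ n
  double-cancel-≤ zero n _ = z≤n
  double-cancel-≤ (suc m) zero ()
  double-cancel-≤ (suc m) (suc n) (s≤s le) rewrite +-suc m m | +-suc n n = s≤s (double-cancel-≤ m n (≤-pred le))

  interleaveBound : ℕ → ℕ → ℕ
  interleaveBound x y = suc (x + x + (y + y))

  interleaveBit-≥ : ∀ x y k → interleaveBound x y ≤ k → interleaveBit x y k ≡ false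
  interleaveBit-≥ x y k le = subst (λ k → interleaveBound x y ≤ k → interleaveBit x y k ≡ false) (pushBit-split k) (go (isOdd k) ⌊ k /2⌋) le
    where
    go : ∀ c i → interleaveBound x y ≤ pushBit c i → interleaveBit x y (pushBit c i) ≡ false
    go false i le = trans (interleaveBit-even i x y) (testBit-≥ i x (double-cancel-≤ x i (≤-trans (≤-trans (m≤m+n (x + x) (y + y)) (n≤1+n _)) le)))
    go true i le = trans (interleaveBit-odd i x y) (testBit-≥ i y (double-cancel-≤ y i (≤-pred (≤-trans (s≤s (m≤n+m (y + y) (x + x))) le))))

  interleave : ℕ → ℕ → ℕ
  interleave x y = fromBits (interleaveBit x y) (interleaveBound x y)

  testBit-interleave : ∀ x y k → testBit (interleave x y) k ≡ interleaveBit x y k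
  testBit-interleave x y = testBit-fromBits (interleaveBound x y) (interleaveBit x y) (interleaveBit-≥ x y)

  testBit-interleave-even : ∀ x y i → testBit (interleave x y) (i + i) ≡ testBit x i
  testBit-interleave-even x y i = trans (testBit-interleave x y (i + i)) (interleaveBit-even i x y)

  testBit-interleave-odd : ∀ x y i → testBit (interleave x y) (suc (i + i)) ≡ testBit y i
  testBit-interleave-odd x y i = trans (testBit-interleave x y (suc (i + i))) (interleaveBit-odd i x y)

  evens : ℕ → ℕ
  evens s = fromBits (λ i → testBit s (i + i)) s

  odds : ℕ → ℕ
  odds s = fromBits (λ i → testBit s (suc (i + i))) s

  testBit-evens : ∀ s i → testBit (evens s) i ≡ testBit s (i + i)
  testBit-evens s = testBit-fromBits s _ (λ k le → testBit-≥ (k + k) s (≤-trans le (m≤m+n k k)))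

  testBit-odds : ∀ s i → testBit (odds s) i ≡ testBit s (suc (i + i))
  testBit-odds s = testBit-fromBits s _ (λ k le → testBit-≥ (suc (k + k)) s (≤-trans le (≤-trans (m≤m+n k k) (n≤1+n _))))

  evens-interleave : ∀ x y → evens (interleave x y) ≡ x
  evens-interleave x y = testBit-ext _ _ (λ i → trans (testBit-evens (interleave x y) i) (testBit-interleave-even x y i))

  odds-interleave : ∀ x y → odds (interleave x y) ≡ y
  odds-interleave x y = testBit-ext _ _ (λ i → trans (testBit-odds (interleave x y) i) (testBit-interleave-odd x y i))

  interleave-split : ∀ s → interleave (evens s) (odds s) ≡ s
  interleave-split s = testBit-ext _ _ λ k → subst (λ k → testBit (interleave (evens s) (odds s)) k ≡ testBit s k) (pushBit-split k) (go (isOdd k) ⌊ k /2⌋)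
    where
    go : ∀ c i → testBit (interleave (evens s) (odds s)) (pushBit c i) ≡ testBit s (pushBit c i)
    go false i = trans (testBit-interleave-even (evens s) (odds s) i) (testBit-evens s i)
    go true i = trans (testBit-interleave-odd (evens s) (odds s) i) (testBit-odds s i)

  double≢odd : ∀ k j → (k + k ≡ suc (j + j)) → ⊥
  double≢odd zero zero ()
  double≢odd zero (suc j) ()
  double≢odd (suc k) zero e rewrite +-suc k k with e
  ... | ()
  double≢odd (suc k) (suc j) e rewrite +-suc k k | +-suc j j = double≢odd k j (suc-injective (suc-injective e))

  double-injective : ∀ k j → k + k ≡ j + j → k ≡ j
  double-injective zero zero e = refl
  double-injective zero (suc j) ()
  double-injective (suc k) zero ()
  double-injective (suc k) (suc j) e rewrite +-suc k k | +-suc j j = cong suc (double-injective k j (suc-injective (suc-injective e)))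

  flipBit-interleave-even : ∀ u w k → flipBit (interleave u w) (k + k) ≡ interleave (flipBit u k) w
  flipBit-interleave-even u w k = testBit-ext _ _ λ j → subst (λ j → testBit (flipBit (interleave u w) (k + k)) j ≡ testBit (interleave (flipBit u k) w) j)
    (pushBit-split j) (go (isOdd j) ⌊ j /2⌋)
    where
    go : ∀ c i → testBit (flipBit (interleave u w) (k + k)) (pushBit c i) ≡ testBit (interleave (flipBit u k) w) (pushBit c i)
    go false i with k ≟ i
    ... | yes refl = trans (testBit-flipBit-same (k + k) (interleave u w)) (trans (cong not (testBit-interleave-even u w k)) (sym (trans (testBit-interleave-even (flipBit u k) w k) (testBit-flipBit-same k u))))
    ... | no nq = trans (testBit-flipBit-other (k + k) (i + i) (interleave u w) (λ e → nq (double-injective k i e)))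
            (trans (testBit-interleave-even u w i) (sym (trans (testBit-interleave-even (flipBit u k) w i) (testBit-flipBit-other k i u nq))))
    go true i = trans (testBit-flipBit-other (k + k) (suc (i + i)) (interleave u w) (double≢odd k i))
            (trans (testBit-interleave-odd u w i) (sym (testBit-interleave-odd (flipBit u k) w i)))

  flipBit-interleave-odd : ∀ u w k → flipBit (interleave u w) (suc (k + k)) ≡ interleave u (flipBit w k)
  flipBit-interleave-odd u w k = testBit-ext _ _ λ j → subst (λ j → testBit (flipBit (interleave u w) (suc (k + k))) j ≡ testBit (interleave u (flipBit w k)) j)
    (pushBit-split j) (go (isOdd j) ⌊ j /2⌋)
    where
    go : ∀ c i → testBit (flipBit (interleave u w) (suc (k + k))) (pushBit c i) ≡ testBit (interleave u (flipBit w k)) (pushBit c i)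
    go true i with k ≟ i
    ... | yes refl = trans (testBit-flipBit-same (suc (k + k)) (interleave u w)) (trans (cong not (testBit-interleave-odd u w k)) (sym (trans (testBit-interleave-odd u (flipBit w k) k) (testBit-flipBit-same k w))))
    ... | no nq = trans (testBit-flipBit-other (suc (k + k)) (suc (i + i)) (interleave u w) (λ e → nq (double-injective k i (suc-injective e))))
            (trans (testBit-interleave-odd u w i) (sym (trans (testBit-interleave-odd u (flipBit w k) i) (testBit-flipBit-other k i w nq))))
    go false i = trans (testBit-flipBit-other (suc (k + k)) (i + i) (interleave u w) (λ e → double≢odd i k (sym e)))
            (trans (testBit-interleave-even u w i) (sym (testBit-interleave-even u (flipBit w k) i)))

  flipBit-involutive : ∀ u k → flipBit (flipBit u k) k ≡ u
  flipBit-involutive u k = testBit-ext _ _ go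
    where
    go : ∀ j → testBit (flipBit (flipBit u k) k) j ≡ testBit u j
    go j with k ≟ j
    ... | yes refl = trans (testBit-flipBit-same k (flipBit u k)) (trans (cong not (testBit-flipBit-same k u)) (not-involutive _))
    ... | no nq = trans (testBit-flipBit-other k j (flipBit u k) nq) (testBit-flipBit-other k j u nq)

  testBit-flipBit-≥ : ∀ u j B → j < B → Fits B u → Fits B (flipBit u j)
  testBit-flipBit-≥ u j B lt h k le = trans (testBit-flipBit-other j k u (λ e → <-irrefl e (<-≤-trans lt le))) (h k le)

  clearBit : ℕ → ℕ → ℕ
  clearBit u j = if testBit u j then flipBit u j else u

  testBit-clearBit-≥ : ∀ u j → Fits (suc j) u → Fits j (clearBit u j)
  testBit-clearBit-≥ u j h k le = go (testBit u j) refl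
    where
    go : ∀ t → testBit u j ≡ t → testBit (if t then flipBit u j else u) k ≡ false
    go true eq with j ≟ k
    ... | yes refl = trans (testBit-flipBit-same j u) (cong not eq)
    ... | no nq = trans (testBit-flipBit-other j k u nq) (h k (≤∧≢⇒< le nq))
    go false eq with j ≟ k
    ... | yes refl = eq
    ... | no nq = h k (≤∧≢⇒< le nq)

  clearBit-cases : ∀ u j → (clearBit u j ≡ u) ⊎ (flipBit (clearBit u j) j ≡ u)
  clearBit-cases u j = go (testBit u j)
    where
    go : ∀ t → ((if t then flipBit u j else u) ≡ u) ⊎ (flipBit (if t then flipBit u j else u) j ≡ u)
    go true = inj₂ (flipBit-involutive u j)
    go false = inj₁ refl

  lowBits-suc : ∀ v u j → lowBits v u (suc j) ≡ lowBits v u j ∧ eqB (testBit u j) v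
  lowBits-suc v u zero = ∧-comm (eqB (isOdd u) v) true
  lowBits-suc v u (suc j) rewrite lowBits-suc v ⌊ u /2⌋ j = sym (∧-assoc (eqB (isOdd u) v) (lowBits v ⌊ u /2⌋ j) _)

  lowBits-ext : ∀ v u u' j → (∀ i → i < j → testBit u i ≡ testBit u' i) → lowBits v u j ≡ lowBits v u' j
  lowBits-ext v u u' zero h = refl
  lowBits-ext v u u' (suc j) h = cong₂ (λ x y → eqB x v ∧ y) (h 0 (s≤s z≤n)) (lowBits-ext v ⌊ u /2⌋ ⌊ u' /2⌋ j (λ i lt → h (suc i) (s≤s lt)))

  lowBits-flipBit : ∀ v u j → lowBits v (flipBit u j) j ≡ lowBits v u j
  lowBits-flipBit v u j = lowBits-ext v _ _ j (λ i lt → testBit-flipBit-other j i u (λ e → <-irrefl (sym e) lt))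

  lowBits-exclusive : ∀ u j → lowBits false u (suc j) ≡ true → lowBits true u (suc j) ≡ true → ⊥
  lowBits-exclusive u j e1 e2 with isOdd u
  lowBits-exclusive u j () e2 | true
  lowBits-exclusive u j e1 () | false

  testBit-clearBit-same : ∀ u j → testBit (clearBit u j) j ≡ false
  testBit-clearBit-same u j = go (testBit u j) refl
    where
    go : ∀ t → testBit u j ≡ t → testBit (if t then flipBit u j else u) j ≡ false
    go true eq = trans (testBit-flipBit-same j u) (cong not eq)
    go false eq = eq

  testBit-clearBit-other : ∀ u j k → j ≢ k → testBit (clearBit u j) k ≡ testBit u k
  testBit-clearBit-other u j k nq = go (testBit u j)
    where
    go : ∀ t → testBit (if t then flipBit u j else u) k ≡ testBit u k
    go true = testBit-flipBit-other j k u nq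
    go false = refl

  lowBits-exclusive-∧ : ∀ u j → lowBits false u (suc j) ∧ lowBits true u (suc j) ≡ true → ⊥
  lowBits-exclusive-∧ u j e with lowBits false u (suc j) in e1 | lowBits true u (suc j) in e2
  ... | true | true = lowBits-exclusive u j e1 e2

  flipBitsBelow : ℕ → ℕ → ℕ
  flipBitsBelow z zero = z
  flipBitsBelow z (suc i) = flipBitsBelow (flipBit z i) i

  flipBitsBelow-< : ∀ j z k → k < j → testBit (flipBitsBelow z j) k ≡ not (testBit z k)
  flipBitsBelow-≥ : ∀ j z k → j ≤ k → testBit (flipBitsBelow z j) k ≡ testBit z k
  flipBitsBelow-< (suc j) z k lt with j ≟ k
  ... | yes refl = trans (flipBitsBelow-≥ j (flipBit z j) j ≤-refl) (testBit-flipBit-same j z)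
  ... | no nq = trans (flipBitsBelow-< j (flipBit z j) k (≤∧≢⇒< (≤-pred lt) (λ e → nq (sym e)))) (cong not (testBit-flipBit-other j k z nq))
  flipBitsBelow-≥ zero z k le = refl
  flipBitsBelow-≥ (suc j) z k le = trans (flipBitsBelow-≥ j (flipBit z j) k (<⇒≤ le)) (testBit-flipBit-other j k z (λ e → <-irrefl e le))

  testBit-carry : ∀ v u t → LowBits v u t → testBit u t ≡ not v →
               ∀ k → testBit (flipBitsBelow (flipBit u t) t) k ≡ testBit u k xor lowBits v u k
  testBit-carry v u t hb ht k with <-cmp k t
  ... | tri< lt _ _ = trans (flipBitsBelow-< t (flipBit u t) k lt)
          (trans (cong not (testBit-flipBit-other t k u (λ e → <-irrefl (sym e) lt)))
            (trans (sym (xor-true (testBit u k))) (cong (testBit u k xor_) (sym (testBit⇒lowBits v u k (λ i lt' → hb i (<-trans lt' lt)))))))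
  ... | tri≈ _ refl _ = trans (flipBitsBelow-≥ t (flipBit u t) t ≤-refl)
          (trans (testBit-flipBit-same t u) (trans (sym (xor-true (testBit u t))) (cong (testBit u t xor_) (sym (testBit⇒lowBits v u t hb)))))
  ... | tri> _ _ gt = trans (flipBitsBelow-≥ t (flipBit u t) k (<⇒≤ gt))
          (trans (testBit-flipBit-other t k u (λ e → <-irrefl e gt)) (trans (sym (xor-identityʳ (testBit u k))) (cong (testBit u k xor_) (sym allf))))
    where
    allf : lowBits v u k ≡ false
    allf with lowBits v u k in e
    ... | false = refl
    ... | true = ⊥-elim (not-¬ refl (trans (sym (lowBits⇒testBit v u k e t gt)) ht))

  first-bit-≢ : ∀ v u m → testBit u m ≡ not v → Σ ℕ λ t → LowBits v u t × (testBit u t ≡ not v)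
  first-bit-≢ v u zero e = 0 , (λ k ()) , e
  first-bit-≢ v u (suc m) e with testBit u 0 in e0 | v
  ... | true | false = 0 , (λ k ()) , e0
  ... | false | true = 0 , (λ k ()) , e0
  ... | true | true = let r = first-bit-≢ true ⌊ u /2⌋ m e in suc (proj₁ r) , hb r , proj₂ (proj₂ r)
    where
    hb : (r : Σ ℕ λ t → LowBits true ⌊ u /2⌋ t × (testBit ⌊ u /2⌋ t ≡ false)) → LowBits true u (suc (proj₁ r))
    hb r zero _ = e0
    hb r (suc k) (s≤s lt) = proj₁ (proj₂ r) k lt
  ... | false | false = let r = first-bit-≢ false ⌊ u /2⌋ m e in suc (proj₁ r) , hb r , proj₂ (proj₂ r)
    where
    hb : (r : Σ ℕ λ t → LowBits false ⌊ u /2⌋ t × (testBit ⌊ u /2⌋ t ≡ true)) → LowBits false u (suc (proj₁ r))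
    hb r zero _ = e0
    hb r (suc k) (s≤s lt) = proj₁ (proj₂ r) k lt

  suc-has-bit : ∀ x → Σ ℕ λ m → testBit (suc x) m ≡ true
  suc-has-bit x = bounded (suc x) (suc x) ≤-refl (λ ())
    where
    bounded : ∀ f n → n ≤ f → n ≢ 0 → Σ ℕ λ m → testBit n m ≡ true
    bounded zero n le nz = ⊥-elim (nz (n≤0⇒n≡0 le))
    bounded (suc f) n le nz with isOdd n in odd
    ... | true = 0 , odd
    ... | false = let (m , bit) = bounded f ⌊ n /2⌋ (half-≤ f n le) (λ e → nz (trans (sym (pushBit-split n)) (cong₂ pushBit odd e))) in
                  suc m , bit

  carry-suc : ∀ u t → LowBits true u t → testBit u t ≡ false → flipBitsBelow (flipBit u t) t ≡ suc u
  carry-suc u t hb ht = testBit-ext _ _ λ k → trans (testBit-carry true u t hb ht k) (sym (testBit-suc k u))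

  carry-pred : ∀ x t → LowBits false (suc x) t → testBit (suc x) t ≡ true → flipBitsBelow (flipBit (suc x) t) t ≡ x
  carry-pred x t hb ht = testBit-ext _ _ λ k → trans (testBit-carry false (suc x) t hb ht k) (sym (testBit-pred k x))

  suc-flipBit-0 : ∀ x → testBit (suc x) 0 ≡ true → flipBit (suc x) 0 ≡ x
  suc-flipBit-0 x e with isOdd (suc x)
  suc-flipBit-0 x refl | true = refl

  Fits-induction : (Q : ℕ → ℕ → Set) → Q 0 0 →
                   (∀ j u → Fits j u → Q j u → Q (suc j) u × Q (suc j) (flipBit u j)) →
                   ∀ j u → Fits j u → Q j u
  Fits-induction Q base step zero u hu = subst (Q 0) (sym (bits-false⇒≡0 u (λ k → hu k z≤n))) base
  Fits-induction Q base step (suc j) u hu =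
    [ (λ eq → subst (Q (suc j)) eq (proj₁ stepped)) , (λ eq → subst (Q (suc j)) eq (proj₂ stepped)) ]′ (clearBit-cases u j)
    where
    fits = testBit-clearBit-≥ u j hu
    stepped = step j (clearBit u j) fits (Fits-induction Q base step j (clearBit u j) fits)

  LowBits-flipBit : ∀ v u t → LowBits v u t → testBit u t ≡ not v → LowBits v (flipBit u t) (suc t)
  LowBits-flipBit v u t hb ht k lt with t ≟ k
  ... | yes refl = trans (testBit-flipBit-same t u) (trans (cong not ht) (not-involutive v))
  ... | no nq = trans (testBit-flipBit-other t k u nq) (hb k (≤∧≢⇒< (≤-pred lt) (λ e → nq (sym e))))

  LowBits-≤ : ∀ {v u j t} → j ≤ t → LowBits v u t → LowBits v u j
  LowBits-≤ j≤t hb k k<j = hb k (<-≤-trans k<j j≤t)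
module Halves where

  open Binary
  open import Data.Nat using (ℕ; zero; suc; _+_)
  open import Data.Nat.Properties using (+-comm; +-identityʳ)
  open import Data.Integer using (ℤ; +_; -[1+_]) renaming (_+_ to _+ℤ_; _-_ to _-ℤ_)
  open import Data.Product using (_×_; _,_)
  open import Relation.Binary.PropositionalEquality

  -- P looks at levels ≥ 0 and M at levels ≤ 0.  Since lamp i+½ is bit (zig i)
  -- of the code, the even bits hold the lamps right of the origin and the odd
  -- bits those to the left; a configuration (u , w) of side σ lists first the
  -- half that σ's generators toggle.
  data Side : Set where
    P M : Side

  opposite : Side → Side
  opposite P = M
  opposite M = P

  Config : Set
  Config = ℕ × ℕ

  encode : Side → Config → ℕ
  encode P (u , w) = interleave u w
  encode M (u , w) = interleave w u

  level : Side → ℕ → ℤ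
  level P k = + k
  level M zero = + 0
  level M (suc k) = -[1+ k ]

  point : Side → Config → ℕ → Lamp
  point σ c k = encode σ c , level σ k

  flipAt : Config → ℕ → Config
  flipAt (u , w) k = flipBit u k , w

  upA upB downA downB : Side → Gen
  upA P = a
  upA M = a⁻¹
  upB P = b
  upB M = b⁻¹
  downA P = a⁻¹
  downA M = a
  downB P = b⁻¹
  downB M = b

  upA-opposite : ∀ σ → upA σ ≡ downA (opposite σ)
  upA-opposite P = refl
  upA-opposite M = refl

  +-suc-level : ∀ k → + k +ℤ + 1 ≡ + suc k
  +-suc-level k = cong +_ (+-comm k 1)

  ∸-suc-level : ∀ k → -[1+ k ] -ℤ + 1 ≡ -[1+ suc k ]
  ∸-suc-level k = cong (λ n → -[1+ suc n ]) (+-identityʳ k)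

  zig-nonneg : ∀ k → zig (+ k) ≡ k + k
  zig-nonneg k = cong (λ n → k + n) (+-identityʳ k)

  toggle-nonneg : ∀ u w k → toggle (interleave u w) (+ k) ≡ interleave (flipBit u k) w
  toggle-nonneg u w k = trans (cong (flipBit (interleave u w)) (zig-nonneg k)) (flipBit-interleave-even u w k)

  toggle-neg : ∀ u w k → toggle (interleave u w) -[1+ k ] ≡ interleave u (flipBit w k)
  toggle-neg u w k = trans (cong (flipBit (interleave u w)) (cong suc (zig-nonneg k))) (flipBit-interleave-odd u w k)

  point-upA : ∀ σ c k → point σ c k · upA σ ≡ point σ c (suc k)
  point-upA P c k = cong (encode P c ,_) (+-suc-level k)
  point-upA M c zero = refl
  point-upA M c (suc k) = cong (encode M c ,_) (∸-suc-level k)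

  point-upB : ∀ σ c k → point σ c k · upB σ ≡ point σ (flipAt c k) (suc k)
  point-upB P (u , w) k = cong₂ _,_ (toggle-nonneg u w k) (+-suc-level k)
  point-upB M (u , w) zero = cong (_, -[1+ 0 ]) (toggle-neg w u 0)
  point-upB M (u , w) (suc k) =
    cong₂ _,_ (trans (cong (toggle (interleave w u)) (∸-suc-level k)) (toggle-neg w u (suc k))) (∸-suc-level k)

  point-downA : ∀ σ c k → point σ c (suc k) · downA σ ≡ point σ c k
  point-downA P c k = refl
  point-downA M c zero = refl
  point-downA M c (suc k) = refl

  point-downB : ∀ σ c k → point σ c (suc k) · downB σ ≡ point σ (flipAt c k) k
  point-downB P (u , w) k = cong (_, + k) (toggle-nonneg u w k)
  point-downB M (u , w) zero = cong (_, + 0) (toggle-neg w u 0)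
  point-downB M (u , w) (suc k) = cong (_, -[1+ k ]) (toggle-neg w u (suc k))

  decode : Side → ℕ → Config
  decode P s = evens s , odds s
  decode M s = odds s , evens s

  encode-decode : ∀ σ s → encode σ (decode σ s) ≡ s
  encode-decode P s = interleave-split s
  encode-decode M s = interleave-split s

  point-decode-origin : ∀ σ s → point σ (decode σ s) 0 ≡ (s , + 0)
  point-decode-origin P s = cong (_, + 0) (interleave-split s)
  point-decode-origin M s = cong (_, + 0) (interleave-split s)

  data Position (σ : Side) : Lamp → Set where
    own   : ∀ c k → Position σ (point σ c k)
    other : ∀ c k → Position σ (point (opposite σ) c (suc k))

  position : ∀ σ g → Position σ g
  position P (s , + k) = subst (λ s → Position P (s , + k)) (encode-decode P s) (own (decode P s) k)
  position P (s , -[1+ k ]) = subst (λ s → Position P (s , -[1+ k ])) (encode-decode M s) (other (decode M s) k)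
  position M (s , + zero) = subst (λ s → Position M (s , + 0)) (encode-decode M s) (own (decode M s) 0)
  position M (s , + suc k) = subst (λ s → Position M (s , + suc k)) (encode-decode P s) (other (decode P s) k)
  position M (s , -[1+ k ]) = subst (λ s → Position M (s , -[1+ k ])) (encode-decode M s) (own (decode M s) (suc k))
module LocalRules where

  open Halves
  open import Data.Nat using (ℕ; zero; suc)
  import Data.Nat.Properties as ℕ
  open import Data.Bool using (Bool; true; false; _∧_; if_then_else_; T)
  import Data.Bool.Properties as Bool
  open import Data.Unit using (tt)
  open import Data.Product using (_×_; _,_; proj₁; proj₂)
  open import Data.Sum using (_⊎_)
  open import Data.Empty using (⊥)
  open import Data.List using (List; []; _∷_)
  open import Data.Bool.ListAction using (all)
  open import Data.List.Membership.Propositional using (_∈_)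
  open import Data.List.Relation.Unary.Any using (here; there)
  open import Data.Vec using (Vec; []; _∷_)
  open import Relation.Binary.Definitions using (DecidableEquality)
  open import Relation.Nullary using (Dec; isYes)
  open import Relation.Nullary.Decidable using (map′; toWitness; _×-dec_; _⊎-dec_; _→-dec_)
  open import Function using (_∘_)
  open import Relation.Binary.PropositionalEquality

  T-∧ : ∀ x {y} → T (x ∧ y) → T x × T y
  T-∧ true t = tt , t

  T-⇒ : ∀ x {y} → T (x ⇒ᵇ y) → T x → T y
  T-⇒ true t _ = t

  T-⇔ : ∀ x y → T (x ⇔ᵇ y) → x ≡ y
  T-⇔ true true _ = refl
  T-⇔ false false _ = refl

  T-all : ∀ {A : Set} (p : A → Bool) xs → T (all p xs) → ∀ {x} → x ∈ xs → T (p x)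
  T-all p (y ∷ ys) t (here refl) = proj₁ (T-∧ (p y) t)
  T-all p (y ∷ ys) t (there x∈ys) = T-all p ys (proj₂ (T-∧ (p y) t)) x∈ys

  module Exhaustive {A : Set} (elems : List A) (complete : ∀ x → x ∈ elems) where

    every : ∀ n → (Vec A n → Bool) → Bool
    every zero f = f []
    every (suc n) f = all (λ x → every n (λ xs → f (x ∷ xs))) elems

    every-sound : ∀ n f → T (every n f) → ∀ xs → T (f xs)
    every-sound zero f t [] = t
    every-sound (suc n) f t (x ∷ xs) =
      every-sound n (λ xs → f (x ∷ xs)) (T-all (λ x → every n (λ xs → f (x ∷ xs))) elems t (complete x)) xs

  retract-≟ : {A : Set} (code : A → ℕ) (decode : ℕ → A) → (∀ x → decode (code x) ≡ x) → DecidableEquality A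
  retract-≟ code decode inv x y =
    map′ (λ e → trans (sym (inv x)) (trans (cong decode e) (inv y))) (cong code) (code x ℕ.≟ code y)

  arrows : List Arrow
  arrows = nw ∷ up ∷ ne ∷ sea ∷ sw ∷ down ∷ se ∷ []

  arrows-complete : ∀ x → x ∈ arrows
  arrows-complete nw = here refl
  arrows-complete up = there (here refl)
  arrows-complete ne = there (there (here refl))
  arrows-complete sea = there (there (there (here refl)))
  arrows-complete sw = there (there (there (there (here refl))))
  arrows-complete down = there (there (there (there (there (here refl)))))
  arrows-complete se = there (there (there (there (there (there (here refl))))))

  open Exhaustive arrows arrows-complete

  arrowOfCode : ℕ → Arrow
  arrowOfCode 0 = nw
  arrowOfCode 1 = up
  arrowOfCode 2 = ne
  arrowOfCode 3 = sea
  arrowOfCode 4 = sw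
  arrowOfCode 5 = down
  arrowOfCode _ = se

  arrowOfCode-codeA : ∀ x → arrowOfCode (codeA x) ≡ x
  arrowOfCode-codeA nw = refl
  arrowOfCode-codeA up = refl
  arrowOfCode-codeA ne = refl
  arrowOfCode-codeA sea = refl
  arrowOfCode-codeA sw = refl
  arrowOfCode-codeA down = refl
  arrowOfCode-codeA se = refl

  _≟A_ : DecidableEquality Arrow
  _≟A_ = retract-≟ codeA arrowOfCode arrowOfCode-codeA

  mark : Side → Λ → Bool
  mark P l = proj₁ (proj₁ l)
  mark M l = proj₂ (proj₁ l)

  bothMarked : Λ → Bool
  bothMarked l = proj₁ (proj₁ l) ∧ proj₂ (proj₁ l)

  arrow : Λ → Arrow
  arrow = proj₂

  zeroRun oneRun mixed : Side → Arrow
  zeroRun P = nw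
  zeroRun M = sw
  oneRun P = ne
  oneRun M = se
  mixed P = up
  mixed M = down

  run : Side → Bool → Arrow
  run σ true = oneRun σ
  run σ false = zeroRun σ

  onSide : Side → Arrow → Bool
  onSide P = isU
  onSide M = isD

  merge : Side → Arrow → Arrow → Arrow
  merge σ x y = if x == mixed σ then y else (if y == mixed σ then x else sea)

  ArrowUp ArrowMerge RunsUp : Side → Arrow → Arrow → Arrow → Set
  ArrowUp σ l u₁ u₂ = onSide σ l ≡ true → (u₁ ≡ mixed σ × u₂ ≡ l) ⊎ (u₁ ≡ l × u₂ ≡ mixed σ)
  ArrowMerge σ l u₁ u₂ = onSide σ u₁ ≡ true → onSide σ u₂ ≡ true → l ≡ merge σ u₁ u₂
  RunsUp σ l u₁ u₂ =
    (l ≡ sea → u₁ ≡ zeroRun σ × u₂ ≡ oneRun σ) × (l ≡ zeroRun σ → u₁ ≡ zeroRun σ) × (l ≡ oneRun σ → u₂ ≡ oneRun σ)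

  arrowUp? : ∀ σ l u₁ u₂ → Dec (ArrowUp σ l u₁ u₂)
  arrowUp? σ l u₁ u₂ =
    (onSide σ l Bool.≟ true) →-dec (((u₁ ≟A mixed σ) ×-dec (u₂ ≟A l)) ⊎-dec ((u₁ ≟A l) ×-dec (u₂ ≟A mixed σ)))

  arrowMerge? : ∀ σ l u₁ u₂ → Dec (ArrowMerge σ l u₁ u₂)
  arrowMerge? σ l u₁ u₂ = (onSide σ u₁ Bool.≟ true) →-dec ((onSide σ u₂ Bool.≟ true) →-dec (l ≟A merge σ u₁ u₂))

  runsUp? : ∀ σ l u₁ u₂ → Dec (RunsUp σ l u₁ u₂)
  runsUp? σ l u₁ u₂ =
    ((l ≟A sea) →-dec ((u₁ ≟A zeroRun σ) ×-dec (u₂ ≟A oneRun σ)))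
    ×-dec (((l ≟A zeroRun σ) →-dec (u₁ ≟A zeroRun σ)) ×-dec ((l ≟A oneRun σ) →-dec (u₂ ≟A oneRun σ)))

  -- Side M reads a tetrahedron upside down: its lower pair is (η (g a), η (g b)).
  seaRuleOn : Side → Arrow → Arrow → Arrow → Arrow → Bool
  seaRuleOn P l₁ l₂ u₁ u₂ = seaRule l₁ l₂ u₁ u₂
  seaRuleOn M l₁ l₂ u₁ u₂ = seaRule u₁ u₂ l₁ l₂

  -- coupleRule reads only the ←-mark of its first and the →-mark of its third
  -- label; m is whichever of the two the side does not fix to true.
  coupleRuleOn : Side → Bool → Arrow → Arrow → Arrow → Arrow → Bool
  coupleRuleOn P m l₁ l₂ u₁ u₂ = coupleRule ((true , false) , l₁) ((false , false) , l₂) ((false , m) , u₁) ((false , false) , u₂)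
  coupleRuleOn M m l₁ l₂ u₁ u₂ = coupleRule ((m , false) , u₁) ((false , false) , u₂) ((false , true) , l₁) ((false , false) , l₂)

  seaRule-claim : Side → Vec Arrow 4 → Bool
  seaRule-claim σ (l₁ ∷ l₂ ∷ u₁ ∷ u₂ ∷ []) =
    seaRuleOn σ l₁ l₂ u₁ u₂ ⇒ᵇ isYes (arrowUp? σ l₁ u₁ u₂ ×-dec arrowMerge? σ l₁ u₁ u₂)

  coupleRule-claim : Side → Bool → Vec Arrow 4 → Bool
  coupleRule-claim σ m (l₁ ∷ l₂ ∷ u₁ ∷ u₂ ∷ []) = coupleRuleOn σ m l₁ l₂ u₁ u₂ ⇒ᵇ isYes (runsUp? σ l₁ u₁ u₂)

  seaRule-check : ∀ σ → T (every 4 (seaRule-claim σ))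
  seaRule-check P = tt
  seaRule-check M = tt

  coupleRule-check : ∀ σ m → T (every 4 (coupleRule-claim σ m))
  coupleRule-check P true = tt
  coupleRule-check P false = tt
  coupleRule-check M true = tt
  coupleRule-check M false = tt

  seaRule-facts : ∀ σ l₁ l₂ u₁ u₂ → T (seaRuleOn σ l₁ l₂ u₁ u₂) → ArrowUp σ l₁ u₁ u₂ × ArrowMerge σ l₁ u₁ u₂
  seaRule-facts σ l₁ l₂ u₁ u₂ =
    toWitness {a? = arrowUp? σ l₁ u₁ u₂ ×-dec arrowMerge? σ l₁ u₁ u₂} ∘ T-⇒ (seaRuleOn σ l₁ l₂ u₁ u₂) (every-sound 4 (seaRule-claim σ) (seaRule-check σ) (l₁ ∷ l₂ ∷ u₁ ∷ u₂ ∷ []))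

  coupleRule-facts : ∀ σ m l₁ l₂ u₁ u₂ → T (coupleRuleOn σ m l₁ l₂ u₁ u₂) → RunsUp σ l₁ u₁ u₂
  coupleRule-facts σ m l₁ l₂ u₁ u₂ =
    toWitness {a? = runsUp? σ l₁ u₁ u₂} ∘ T-⇒ (coupleRuleOn σ m l₁ l₂ u₁ u₂) (every-sound 4 (coupleRule-claim σ m) (coupleRule-check σ m) (l₁ ∷ l₂ ∷ u₁ ∷ u₂ ∷ []))

  leftRule-up : ∀ β γ δ → T (leftRule true β γ δ) → γ ≡ true × δ ≡ true
  leftRule-up β true true _ = refl , refl
  leftRule-up β true false ()
  leftRule-up β false δ ()

  leftRule-exclusive : ∀ δ → T (leftRule true true true δ) → ⊥
  leftRule-exclusive true ()
  leftRule-exclusive false ()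

  record LocalFacts (σ : Side) (L₁ L₂ U₁ U₂ : Λ) : Set where
    field
      mark-up : mark σ L₁ ≡ true → mark σ U₁ ≡ true × mark σ U₂ ≡ true
      mark-exclusive : mark σ U₁ ≡ true → mark σ L₁ ≡ true → mark σ L₂ ≡ true → ⊥
      oppMark-down : mark (opposite σ) U₁ ≡ true → mark (opposite σ) L₁ ≡ true × mark (opposite σ) L₂ ≡ true
      bothMarked-up : bothMarked L₁ ≡ bothMarked U₁
      arrow-up : ArrowUp σ (arrow L₁) (arrow U₁) (arrow U₂)
      arrow-merge : ArrowMerge σ (arrow L₁) (arrow U₁) (arrow U₂)
      runs-up : mark σ L₁ ≡ true → RunsUp σ (arrow L₁) (arrow U₁) (arrow U₂)

  -- rightRule α β γ δ is leftRule γ δ α β, so both sides and both marks are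
  -- governed by leftRule once lower and upper labels are put in place.
  module _ (σ : Side) {L₁ L₂ U₁ U₂ : Λ}
    (ownRule : T (leftRule (mark σ L₁) (mark σ L₂) (mark σ U₁) (mark σ U₂)))
    (oppRule : T (leftRule (mark (opposite σ) U₁) (mark (opposite σ) U₂) (mark (opposite σ) L₁) (mark (opposite σ) L₂)))
    (bothMarked-up : bothMarked L₁ ≡ bothMarked U₁)
    (seaFacts : ArrowUp σ (arrow L₁) (arrow U₁) (arrow U₂) × ArrowMerge σ (arrow L₁) (arrow U₁) (arrow U₂))
    (runs-up : mark σ L₁ ≡ true → RunsUp σ (arrow L₁) (arrow U₁) (arrow U₂)) where

    mkLocalFacts : LocalFacts σ L₁ L₂ U₁ U₂
    mkLocalFacts = record
      { mark-up = λ l → leftRule-up (mark σ L₂) (mark σ U₁) (mark σ U₂)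
          (subst (λ m → T (leftRule m (mark σ L₂) (mark σ U₁) (mark σ U₂))) l ownRule)
      ; mark-exclusive = λ u l₁ l₂ → leftRule-exclusive (mark σ U₂)
          (subst (λ m → T (leftRule true true m (mark σ U₂))) u
            (subst (λ m → T (leftRule true m (mark σ U₁) (mark σ U₂))) l₂
              (subst (λ m → T (leftRule m (mark σ L₂) (mark σ U₁) (mark σ U₂))) l₁ ownRule)))
      ; oppMark-down = λ u → leftRule-up (mark σ′ U₂) (mark σ′ L₁) (mark σ′ L₂)
          (subst (λ m → T (leftRule m (mark σ′ U₂) (mark σ′ L₁) (mark σ′ L₂))) u oppRule)
      ; bothMarked-up = bothMarked-up
      ; arrow-up = proj₁ seaFacts
      ; arrow-merge = proj₂ seaFacts
      ; runs-up = runs-up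
      }
      where σ′ = opposite σ

  module Derive (η : Lamp → Λ) (h : InΩ η) where

    rules : ∀ g → let L₁ = η g ; L₂ = η (g · a · b⁻¹) ; U₁ = η (g · a) ; U₂ = η (g · b) in
              T (lrRule (proj₁ L₁) (proj₁ L₂) (proj₁ U₁) (proj₁ U₂)) × T (seaRule (arrow L₁) (arrow L₂) (arrow U₁) (arrow U₂))
              × T (coupleRule L₁ L₂ U₁ U₂)
    rules g = markR , T-∧ (seaRule (arrow L₁) (arrow L₂) (arrow U₁) (arrow U₂)) rest
      where
      L₁ = η g
      L₂ = η (g · a · b⁻¹)
      U₁ = η (g · a)
      U₂ = η (g · b)
      split = T-∧ (lrRule (proj₁ L₁) (proj₁ L₂) (proj₁ U₁) (proj₁ U₂)) (h g)
      markR = proj₁ split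
      rest = proj₂ split

    tetrahedronP : ∀ g → LocalFacts P (η g) (η (g · a · b⁻¹)) (η (g · a)) (η (g · b))
    tetrahedronP g = mkLocalFacts P ownR oppR (T-⇔ _ _ both) (seaRule-facts P (arrow L₁) (arrow L₂) (arrow U₁) (arrow U₂) seaR)
                       (λ l → coupleRule-facts P (mark M U₁) (arrow L₁) (arrow L₂) (arrow U₁) (arrow U₂)
                                (subst (λ m → T (coupleRule ((m , mark M L₁) , arrow L₁) L₂ U₁ U₂)) l coupleR))
      where
      L₁ = η g
      L₂ = η (g · a · b⁻¹)
      U₁ = η (g · a)
      U₂ = η (g · b)
      markR = proj₁ (rules g)
      seaR = proj₁ (proj₂ (rules g))
      coupleR = proj₂ (proj₂ (rules g))
      split = T-∧ (leftRule (mark P L₁) (mark P L₂) (mark P U₁) (mark P U₂)) markR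
      ownR = proj₁ split
      oppR = proj₁ (T-∧ (rightRule (mark M L₁) (mark M L₂) (mark M U₁) (mark M U₂)) (proj₂ split))
      both = proj₂ (T-∧ (rightRule (mark M L₁) (mark M L₂) (mark M U₁) (mark M U₂)) (proj₂ split))

    tetrahedronM : ∀ g → LocalFacts M (η (g · a)) (η (g · b)) (η g) (η (g · a · b⁻¹))
    tetrahedronM g = mkLocalFacts M ownR oppR (sym (T-⇔ _ _ both)) (seaRule-facts M (arrow L₁) (arrow L₂) (arrow U₁) (arrow U₂) seaR)
                       (λ l → coupleRule-facts M (mark P U₁) (arrow L₁) (arrow L₂) (arrow U₁) (arrow U₂)
                                (subst (λ m → T (coupleRule U₁ U₂ ((mark P L₁ , m) , arrow L₁) L₂)) l coupleR))
      where
      U₁ = η g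
      U₂ = η (g · a · b⁻¹)
      L₁ = η (g · a)
      L₂ = η (g · b)
      markR = proj₁ (rules g)
      seaR = proj₁ (proj₂ (rules g))
      coupleR = proj₂ (proj₂ (rules g))
      split = T-∧ (leftRule (mark P U₁) (mark P U₂) (mark P L₁) (mark P L₂)) markR
      oppR = proj₁ split
      ownR = proj₁ (T-∧ (rightRule (mark M U₁) (mark M U₂) (mark M L₁) (mark M L₂)) (proj₂ split))
      both = proj₂ (T-∧ (rightRule (mark M U₁) (mark M U₂) (mark M L₁) (mark M L₂)) (proj₂ split))

    LocalFacts-cong : ∀ {σ L₁ L₂ U₁ U₂ L₁′ L₂′ U₁′ U₂′} → L₁ ≡ L₁′ → L₂ ≡ L₂′ → U₁ ≡ U₁′ → U₂ ≡ U₂′ →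
                      LocalFacts σ L₁ L₂ U₁ U₂ → LocalFacts σ L₁′ L₂′ U₁′ U₂′
    LocalFacts-cong refl refl refl refl r = r

    localFacts : ∀ σ c k → LocalFacts σ (η (point σ c k)) (η (point σ (flipAt c k) k))
                                       (η (point σ c (suc k))) (η (point σ (flipAt c k) (suc k)))
    localFacts P c k =
      LocalFacts-cong refl (cong η (trans (cong (_· b⁻¹) (point-upA P c k)) (point-downB P c k)))
        (cong η (point-upA P c k)) (cong η (point-upB P c k)) (tetrahedronP (point P c k))
    localFacts M c k =
      LocalFacts-cong (cong η (point-downA M c k)) (cong η (point-downB M c k)) refl
        (cong η (trans (cong (_· b⁻¹) (point-downA M c k)) (point-upB M c k))) (tetrahedronM (point M c (suc k)))
module Characterisation where

  open Binary
  open Halves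
  open LocalRules
  open import Data.Nat as N using (ℕ; zero; suc; _≤_; _<_; z≤n; s≤s)
  import Data.Nat.Properties as NP
  open import Data.Integer using (+_)
  open import Data.Bool using (Bool; true; false; _∧_; not; if_then_else_)
  open import Data.Product using (_×_; _,_; proj₁; proj₂)
  open import Data.Sum using (_⊎_; inj₁; inj₂)
  open import Data.Empty using (⊥; ⊥-elim)
  open import Relation.Binary.PropositionalEquality
  open import Relation.Nullary using (yes; no)

  predictedArrow : Side → ℕ → ℕ → Arrow
  predictedArrow σ u zero = sea
  predictedArrow σ u (suc j) = if lowBits false u (suc j) then zeroRun σ else (if lowBits true u (suc j) then oneRun σ else mixed σ)

  arrowFromRunsAndBit : Side → Bool → Bool → Bool → Arrow
  arrowFromRunsAndBit σ a0 a1 bt = if a0 ∧ eqB bt false then zeroRun σ else (if a1 ∧ eqB bt true then oneRun σ else mixed σ)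

  arrowFromRuns : Side → Bool → Bool → Arrow
  arrowFromRuns σ a0 a1 = if a0 then zeroRun σ else (if a1 then oneRun σ else mixed σ)

  predictedArrow-suc : ∀ σ u j → predictedArrow σ u (suc j) ≡ arrowFromRunsAndBit σ (lowBits false u j) (lowBits true u j) (testBit u j)
  predictedArrow-suc σ u j rewrite lowBits-suc false u j | lowBits-suc true u j = refl

  predictedArrow-flipBit : ∀ σ u j → predictedArrow σ (flipBit u j) (suc j)
                            ≡ arrowFromRunsAndBit σ (lowBits false u j) (lowBits true u j) (not (testBit u j))
  predictedArrow-flipBit σ u j =
    trans (predictedArrow-suc σ (flipBit u j) j)
      (trans (cong₂ (λ x y → arrowFromRunsAndBit σ x y (testBit (flipBit u j) j)) (lowBits-flipBit false u j) (lowBits-flipBit true u j))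
             (cong (arrowFromRunsAndBit σ (lowBits false u j) (lowBits true u j)) (testBit-flipBit-same j u)))

  merge-arrowFromRunsAndBit : ∀ σ a0 a1 bt → (a0 ∧ a1 ≡ true → ⊥) → merge σ (arrowFromRunsAndBit σ a0 a1 bt) (arrowFromRunsAndBit σ a0 a1 (not bt)) ≡ arrowFromRuns σ a0 a1
  merge-arrowFromRunsAndBit P true true bt ab = ⊥-elim (ab refl)
  merge-arrowFromRunsAndBit P true false true ab = refl
  merge-arrowFromRunsAndBit P true false false ab = refl
  merge-arrowFromRunsAndBit P false true true ab = refl
  merge-arrowFromRunsAndBit P false true false ab = refl
  merge-arrowFromRunsAndBit P false false true ab = refl
  merge-arrowFromRunsAndBit P false false false ab = refl
  merge-arrowFromRunsAndBit M true true bt ab = ⊥-elim (ab refl)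
  merge-arrowFromRunsAndBit M true false true ab = refl
  merge-arrowFromRunsAndBit M true false false ab = refl
  merge-arrowFromRunsAndBit M false true true ab = refl
  merge-arrowFromRunsAndBit M false true false ab = refl
  merge-arrowFromRunsAndBit M false false true ab = refl
  merge-arrowFromRunsAndBit M false false false ab = refl

  zeroRun-onSide : ∀ σ → onSide σ (zeroRun σ) ≡ true
  zeroRun-onSide P = refl
  zeroRun-onSide M = refl

  oneRun-onSide : ∀ σ → onSide σ (oneRun σ) ≡ true
  oneRun-onSide P = refl
  oneRun-onSide M = refl

  mixed-onSide : ∀ σ → onSide σ (mixed σ) ≡ true
  mixed-onSide P = refl
  mixed-onSide M = refl

  arrowFromRunsAndBit-onSide : ∀ σ a0 a1 bt → onSide σ (arrowFromRunsAndBit σ a0 a1 bt) ≡ true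
  arrowFromRunsAndBit-onSide σ a0 a1 bt with a0 ∧ eqB bt false | a1 ∧ eqB bt true
  ... | true | _ = zeroRun-onSide σ
  ... | false | true = oneRun-onSide σ
  ... | false | false = mixed-onSide σ

  predictedArrow-onSide : ∀ σ u j → onSide σ (predictedArrow σ u (suc j)) ≡ true
  predictedArrow-onSide σ u j rewrite predictedArrow-suc σ u j = arrowFromRunsAndBit-onSide σ (lowBits false u j) (lowBits true u j) (testBit u j)

  predictedArrow-run : ∀ σ v u j → lowBits v u (suc j) ≡ true → predictedArrow σ u (suc j) ≡ run σ v
  predictedArrow-run σ false u j e rewrite e = refl
  predictedArrow-run σ true u j e with lowBits false u (suc j) in e0
  ... | true = ⊥-elim (lowBits-exclusive u j e0 e)
  ... | false rewrite e = refl

  arrowFromRuns-run⁻¹ : ∀ σ v a0 a1 → arrowFromRuns σ a0 a1 ≡ run σ v → (if v then a1 else a0) ≡ true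
  arrowFromRuns-run⁻¹ P false true a1 e = refl
  arrowFromRuns-run⁻¹ P false false true ()
  arrowFromRuns-run⁻¹ P false false false ()
  arrowFromRuns-run⁻¹ P true true a1 ()
  arrowFromRuns-run⁻¹ P true false true e = refl
  arrowFromRuns-run⁻¹ P true false false ()
  arrowFromRuns-run⁻¹ M false true a1 e = refl
  arrowFromRuns-run⁻¹ M false false true ()
  arrowFromRuns-run⁻¹ M false false false ()
  arrowFromRuns-run⁻¹ M true true a1 ()
  arrowFromRuns-run⁻¹ M true false true e = refl
  arrowFromRuns-run⁻¹ M true false false ()

  predictedArrow-run⁻¹ : ∀ σ v u j → predictedArrow σ u (suc j) ≡ run σ v → lowBits v u (suc j) ≡ true
  predictedArrow-run⁻¹ σ false u j e = arrowFromRuns-run⁻¹ σ false (lowBits false u (suc j)) (lowBits true u (suc j)) e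
  predictedArrow-run⁻¹ σ true u j e = arrowFromRuns-run⁻¹ σ true (lowBits false u (suc j)) (lowBits true u (suc j)) e

  mixed≢zeroRun : ∀ σ → mixed σ ≢ zeroRun σ
  mixed≢zeroRun P ()
  mixed≢zeroRun M ()

  mixed≢oneRun : ∀ σ → mixed σ ≢ oneRun σ
  mixed≢oneRun P ()
  mixed≢oneRun M ()

  opposite-involutive : ∀ σ → opposite (opposite σ) ≡ σ
  opposite-involutive P = refl
  opposite-involutive M = refl

  point-opposite-origin : ∀ σ w → point (opposite σ) (w , 0) 0 ≡ point σ (0 , w) 0
  point-opposite-origin P w = refl
  point-opposite-origin M w = refl

  bothMarked⇒mark : ∀ σ (l : Λ) → bothMarked l ≡ true → mark σ l ≡ true
  bothMarked⇒mark P ((true , true) , _) e = refl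
  bothMarked⇒mark M ((true , true) , _) e = refl

  module Labels (η : Lamp → Λ) (h : InΩ η) (h1 : η one ≡ ((true , true) , sea)) where
    open Derive η h

    axis-bothMarked : ∀ σ k → bothMarked (η (point σ (0 , 0) k)) ≡ true
    axis-bothMarked P zero rewrite h1 = refl
    axis-bothMarked M zero rewrite h1 = refl
    axis-bothMarked σ (suc k) = trans (sym (LocalFacts.bothMarked-up (localFacts σ (0 , 0) k))) (axis-bothMarked σ k)

    -- Downward induction from level K, where u must vanish and the elements
    -- with no lamps on carry both marks.
    oppMark-below : ∀ τ K t i → i N.+ t ≡ K → ∀ u → Fits K u → LowBits false u i →
        mark (opposite τ) (η (point τ (u , 0) i)) ≡ true
    oppMark-below τ K zero i e u hK hi rewrite NP.+-identityʳ i | e =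
      subst (λ z → mark (opposite τ) (η (point τ (z , 0) K)) ≡ true)
        (sym (bits-false⇒≡0 u (λ k → go k))) (bothMarked⇒mark (opposite τ) _ (axis-bothMarked τ K))
      where
      go : ∀ k → testBit u k ≡ false
      go k with NP.<-≤-connex k K
      ... | inj₁ lt = hi k lt
      ... | inj₂ le = hK k le
    oppMark-below τ K (suc t) i e u hK hi = fin (clearBit-cases u i)
      where
      i<K : i < K
      i<K = subst (i <_) e (NP.m<m+n i (s≤s z≤n))
      u'' = clearBit u i
      hK'' : Fits K u''
      hK'' k le = trans (testBit-clearBit-other u i k (λ e' → NP.<-irrefl e' (NP.<-≤-trans i<K le))) (hK k le)
      hi'' : LowBits false u'' (suc i)
      hi'' k lt with i N.≟ k
      ... | yes refl = testBit-clearBit-same u i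
      ... | no nq = trans (testBit-clearBit-other u i k nq) (hi k (NP.≤∧≢⇒< (NP.≤-pred lt) (λ e' → nq (sym e'))))
      ih = oppMark-below τ K t (suc i) (trans (sym (NP.+-suc i t)) e) u'' hK'' hi''
      ko = LocalFacts.oppMark-down (localFacts τ (u'' , 0) i) ih
      fin : (u'' ≡ u) ⊎ (flipBit u'' i ≡ u) → mark (opposite τ) (η (point τ (u , 0) i)) ≡ true
      fin (inj₁ eq) = subst (λ z → mark (opposite τ) (η (point τ (z , 0) i)) ≡ true) eq (proj₁ ko)
      fin (inj₂ eq) = subst (λ z → mark (opposite τ) (η (point τ (z , 0) i)) ≡ true) eq (proj₂ ko)

    mark-origin : ∀ σ w → mark σ (η (point σ (0 , w) 0)) ≡ true
    mark-origin σ w = subst₂ (λ s g → mark s (η g) ≡ true) (opposite-involutive σ) (point-opposite-origin σ w)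
      (oppMark-below (opposite σ) w w 0 refl w (λ k le → testBit-≥ k w le) (λ k ()))

    mark-if-small : ∀ σ w j u → Fits j u → mark σ (η (point σ (u , w) j)) ≡ true
    mark-if-small σ w = Fits-induction (λ j u → mark σ (η (point σ (u , w) j)) ≡ true) (mark-origin σ w)
      (λ j u _ marked → LocalFacts.mark-up (localFacts σ (u , w) j) marked)

    mark-upward : ∀ σ c j d → mark σ (η (point σ c j)) ≡ true → mark σ (η (point σ c ((d N.+ j)))) ≡ true
    mark-upward σ c j zero e = e
    mark-upward σ c j (suc d) e = proj₁ (LocalFacts.mark-up (localFacts σ c (d N.+ j)) (mark-upward σ c j d e))

    -- A set bit i ≥ j of u would make both u and flipBit u i marked at level i
    -- below a marked point, which leftRule excludes.
    mark-only-if-small : ∀ σ u w j → mark σ (η (point σ (u , w) j)) ≡ true → Fits j u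
    mark-only-if-small σ u w j e = fin (NP.≤-total j u)
      where
      step : ∀ i → j ≤ i → Fits (suc i) u → Fits i u
      step i ji hs k le with i N.≟ k
      ... | no nq = hs k (NP.≤∧≢⇒< le nq)
      ... | yes refl with testBit u i in eqb
      ...   | false = refl
      ...   | true = ⊥-elim (LocalFacts.mark-exclusive (localFacts σ (u , w) i) u1 l1 l2)
        where
        l1 : mark σ (η (point σ (u , w) i)) ≡ true
        l1 = subst (λ z → mark σ (η (point σ (u , w) z)) ≡ true) (NP.m∸n+n≡m ji) (mark-upward σ (u , w) j (i N.∸ j) e)
        u1 = proj₁ (LocalFacts.mark-up (localFacts σ (u , w) i) l1)
        l2 : mark σ (η (point σ (flipBit u i , w) i)) ≡ true
        l2 = mark-if-small σ w i (flipBit u i) go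
          where
          go : Fits i (flipBit u i)
          go k le' with i N.≟ k
          ... | yes refl = trans (testBit-flipBit-same i u) (cong not eqb)
          ... | no nq = trans (testBit-flipBit-other i k u nq) (hs k (NP.≤∧≢⇒< le' nq))
      dwn : ∀ t i → i N.+ t ≡ u → j ≤ i → Fits i u
      dwn zero i e' ji k le = testBit-≥ k u (subst (_≤ k) (trans (sym (NP.+-identityʳ i)) e') le)
      dwn (suc t) i e' ji = step i ji (dwn t (suc i) (trans (sym (NP.+-suc i t)) e') (NP.m≤n⇒m≤1+n ji))
      fin : (j ≤ u) ⊎ (u ≤ j) → Fits j u
      fin (inj₁ le) = dwn (u N.∸ j) j (NP.m+[n∸m]≡n le) NP.≤-refl
      fin (inj₂ le) k jk = testBit-≥ k u (NP.≤-trans le jk)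

    ArrowCorrect : Side → ℕ → ℕ → ℕ → Set
    ArrowCorrect σ w u j = arrow (η (point σ (u , w) j)) ≡ predictedArrow σ u j

    arrows-above : ∀ σ (L1 L2 U1 U2 : Λ) → LocalFacts σ L1 L2 U1 U2 → mark σ L1 ≡ true → ∀ a0 a1 → (a0 ∧ a1 ≡ true → ⊥) →
               arrow L1 ≡ arrowFromRuns σ a0 a1 → arrow U1 ≡ arrowFromRunsAndBit σ a0 a1 false × arrow U2 ≡ arrowFromRunsAndBit σ a0 a1 true
    arrows-above σ L1 L2 U1 U2 r c true true ab e = ⊥-elim (ab refl)
    arrows-above σ L1 L2 U1 U2 r c true false ab e with LocalFacts.arrow-up r (trans (cong (onSide σ) e) (zeroRun-onSide σ))
    ... | inj₁ (u1 , _) = ⊥-elim (mixed≢zeroRun σ (trans (sym u1) (proj₁ (proj₂ (LocalFacts.runs-up r c)) e)))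
    ... | inj₂ (u1 , u2) = proj₁ (proj₂ (LocalFacts.runs-up r c)) e , u2
    arrows-above σ L1 L2 U1 U2 r c false true ab e with LocalFacts.arrow-up r (trans (cong (onSide σ) e) (oneRun-onSide σ))
    ... | inj₁ (u1 , _) = u1 , proj₂ (proj₂ (LocalFacts.runs-up r c)) e
    ... | inj₂ (_ , u2) = ⊥-elim (mixed≢oneRun σ (trans (sym u2) (proj₂ (proj₂ (LocalFacts.runs-up r c)) e)))
    arrows-above σ L1 L2 U1 U2 r c false false ab e with LocalFacts.arrow-up r (trans (cong (onSide σ) e) (mixed-onSide σ))
    ... | inj₁ (u1 , u2) = u1 , trans u2 e
    ... | inj₂ (u1 , u2) = trans u1 e , u2

    arrowCorrect-above : ∀ σ w j u → Fits j u → ArrowCorrect σ w u j →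
        arrow (η (point σ (u , w) (suc j))) ≡ arrowFromRunsAndBit σ (lowBits false u j) (lowBits true u j) false
      × arrow (η (point σ (flipBit u j , w) (suc j))) ≡ arrowFromRunsAndBit σ (lowBits false u j) (lowBits true u j) true
    arrowCorrect-above σ w zero u hu cor = proj₁ (LocalFacts.runs-up (localFacts σ (u , w) zero) (mark-if-small σ w zero u hu)) cor
    arrowCorrect-above σ w (suc i) u hu cor =
      arrows-above σ _ _ _ _ (localFacts σ (u , w) (suc i)) (mark-if-small σ w (suc i) u hu)
        (lowBits false u (suc i)) (lowBits true u (suc i)) (lowBits-exclusive-∧ u i) cor

    arrowCorrect-upward : ∀ σ w j u → Fits j u → ArrowCorrect σ w u j →
                          ArrowCorrect σ w u (suc j) × ArrowCorrect σ w (flipBit u j) (suc j)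
    arrowCorrect-upward σ w j u hu cor = trans (proj₁ above) (sym clear) , trans (proj₂ above) (sym set)
      where
      bit-j = hu j NP.≤-refl
      clear : predictedArrow σ u (suc j) ≡ arrowFromRunsAndBit σ (lowBits false u j) (lowBits true u j) false
      clear = trans (predictedArrow-suc σ u j) (cong (arrowFromRunsAndBit σ (lowBits false u j) (lowBits true u j)) bit-j)
      set : predictedArrow σ (flipBit u j) (suc j) ≡ arrowFromRunsAndBit σ (lowBits false u j) (lowBits true u j) true
      set = trans (predictedArrow-flipBit σ u j) (cong (λ b → arrowFromRunsAndBit σ (lowBits false u j) (lowBits true u j) (not b)) bit-j)
      above = arrowCorrect-above σ w j u hu cor

    merge-full : ∀ σ bt → merge σ (arrowFromRunsAndBit σ true true bt) (arrowFromRunsAndBit σ true true (not bt)) ≡ sea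
    merge-full P true = refl
    merge-full P false = refl
    merge-full M true = refl
    merge-full M false = refl

    merge-predicted : ∀ σ u j → merge σ (arrowFromRunsAndBit σ (lowBits false u j) (lowBits true u j) (testBit u j)) (arrowFromRunsAndBit σ (lowBits false u j) (lowBits true u j) (not (testBit u j))) ≡ predictedArrow σ u j
    merge-predicted σ u zero = merge-full σ (testBit u 0)
    merge-predicted σ u (suc j) = merge-arrowFromRunsAndBit σ (lowBits false u (suc j)) (lowBits true u (suc j)) (testBit u (suc j)) (lowBits-exclusive-∧ u j)

    arrowCorrect-downward : ∀ σ w j u → ArrowCorrect σ w u (suc j) → ArrowCorrect σ w (flipBit u j) (suc j) → ArrowCorrect σ w u j
    arrowCorrect-downward σ w j u c1 c2 = trans a3 (trans (cong₂ (merge σ) (trans c1 (predictedArrow-suc σ u j)) (trans c2 (predictedArrow-flipBit σ u j))) (merge-predicted σ u j))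
      where
      a3 = LocalFacts.arrow-merge (localFacts σ (u , w) j) (trans (cong (onSide σ) c1) (predictedArrow-onSide σ u j)) (trans (cong (onSide σ) c2) (predictedArrow-onSide σ (flipBit u j) j))

    module _ (σ : Side) (w : ℕ) (base : arrow (η (point σ (0 , w) 0)) ≡ sea) where
      arrowCorrect-small : ∀ j u → Fits j u → ArrowCorrect σ w u j
      arrowCorrect-small = Fits-induction (λ j u → ArrowCorrect σ w u j) base (arrowCorrect-upward σ w)

      arrowCorrect : ∀ u j → ArrowCorrect σ w u j
      arrowCorrect u j = Dn u (trans (NP.+-comm j u) refl) u (λ k le → testBit-≥ k u (NP.≤-trans (NP.m≤m+n u j) le))
        where
        B = u N.+ j
        Dn : ∀ t {i} → i N.+ t ≡ B → ∀ u' → Fits B u' → ArrowCorrect σ w u' i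
        Dn zero {i} e u' hb = arrowCorrect-small i u' (λ k le → hb k (subst (_≤ k) (trans (sym (NP.+-identityʳ i)) e) le))
        Dn (suc t) {i} e u' hb =
          arrowCorrect-downward σ w i u' (Dn t e' u' hb) (Dn t e' (flipBit u' i) (testBit-flipBit-≥ u' i B i<B hb))
          where
          e' : suc i N.+ t ≡ B
          e' = trans (sym (NP.+-suc i t)) e
          i<B : i < B
          i<B = subst (i <_) e (NP.m<m+n i (s≤s z≤n))

    seaLevel-P : ∀ u → arrow (η (point P (u , 0) 0)) ≡ sea
    seaLevel-P u = arrowCorrect P 0 (cong arrow h1) u 0

    seaLevel : ∀ s → arrow (η (s , + 0)) ≡ sea
    seaLevel s = subst (λ z → arrow (η (z , + 0)) ≡ sea) (interleave-split s) (arrowCorrect M (evens s) (seaLevel-P (evens s)) (odds s) 0)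

    arrow-predicted : ∀ σ u w j → arrow (η (point σ (u , w) j)) ≡ predictedArrow σ u j
    arrow-predicted P u w j = arrowCorrect P w (seaLevel (interleave 0 w)) u j
    arrow-predicted M u w j = arrowCorrect M w (seaLevel (interleave w 0)) u j

    arrow-onSide : ∀ σ c j → onSide σ (arrow (η (point σ c (suc j)))) ≡ true
    arrow-onSide σ (u , w) j = trans (cong (onSide σ) (arrow-predicted σ u w (suc j))) (predictedArrow-onSide σ u j)

    aboveSea : ∀ σ c j → arrow (η (point σ c (suc j))) ≡ sea → ⊥
    aboveSea σ c j e = sea-offSide σ (trans (cong (onSide σ) (sym e)) (arrow-onSide σ c j))
      where
      sea-offSide : ∀ σ → onSide σ sea ≡ true → ⊥
      sea-offSide P ()
      sea-offSide M ()

    seaLevel-point : ∀ σ c → arrow (η (point σ c 0)) ≡ sea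
    seaLevel-point P c = seaLevel (encode P c)
    seaLevel-point M c = seaLevel (encode M c)

module Simulator where

  open Binary
  open Halves
  open LocalRules
  open import Data.Nat as N using (ℕ; zero; suc)
  open import Data.Bool using (Bool; true; false; not; if_then_else_)
  open import Data.Product using (_×_; _,_; proj₁; proj₂)
  open import Data.Sum using (_⊎_; inj₁; inj₂)
  open import Data.Fin using (Fin; splitAt; join; remQuot; combine) renaming (zero to fz; suc to fs)
  import Data.Fin.Properties as FP
  open import Relation.Binary.PropositionalEquality

  data Phase : Set where
    climbing turning descending : Phase

  data Code : Set where
    cB cS cPh : Code
    _⊗_ _⊕_ : Code → Code → Code

  infixr 5 _⊗_
  infixr 4 _⊕_

  ⟦_⟧ : Code → Set
  ⟦ cB ⟧ = Bool
  ⟦ cS ⟧ = Side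
  ⟦ cPh ⟧ = Phase
  ⟦ c ⊗ d ⟧ = ⟦ c ⟧ × ⟦ d ⟧
  ⟦ c ⊕ d ⟧ = ⟦ c ⟧ ⊎ ⟦ d ⟧

  size : Code → ℕ
  size cB = 2
  size cS = 2
  size cPh = 3
  size (c ⊗ d) = size c N.* size d
  size (c ⊕ d) = size c N.+ size d

  enc : (c : Code) → ⟦ c ⟧ → Fin (size c)
  enc cB true = fz
  enc cB false = fs fz
  enc cS P = fz
  enc cS M = fs fz
  enc cPh climbing = fz
  enc cPh turning = fs fz
  enc cPh descending = fs (fs fz)
  enc (c ⊗ d) (x , y) = combine (enc c x) (enc d y)
  enc (c ⊕ d) x = join (size c) (size d) (Data.Sum.map (enc c) (enc d) x)

  dec : (c : Code) → Fin (size c) → ⟦ c ⟧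
  dec cB fz = true
  dec cB (fs fz) = false
  dec cS fz = P
  dec cS (fs fz) = M
  dec cPh fz = climbing
  dec cPh (fs fz) = turning
  dec cPh (fs (fs fz)) = descending
  dec (c ⊗ d) i = dec c (proj₁ (remQuot {size c} (size d) i)) , dec d (proj₂ (remQuot {size c} (size d) i))
  dec (c ⊕ d) i = Data.Sum.map (dec c) (dec d) (splitAt (size c) i)

  dec-enc : (c : Code) (x : ⟦ c ⟧) → dec c (enc c x) ≡ x
  dec-enc cB true = refl
  dec-enc cB false = refl
  dec-enc cS P = refl
  dec-enc cS M = refl
  dec-enc cPh climbing = refl
  dec-enc cPh turning = refl
  dec-enc cPh descending = refl
  dec-enc (c ⊗ d) (x , y) = trans (cong (λ r → dec c (proj₁ r) , dec d (proj₂ r)) (FP.remQuot-combine {size c} {size d} (enc c x) (enc d y))) (cong₂ _,_ (dec-enc c x) (dec-enc d y))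
  dec-enc (c ⊕ d) (inj₁ x) rewrite FP.splitAt-join (size c) (size d) (inj₁ (enc c x)) = cong inj₁ (dec-enc c x)
  dec-enc (c ⊕ d) (inj₂ y) rewrite FP.splitAt-join (size c) (size d) (inj₂ (enc d y)) = cong inj₂ (dec-enc d y)

  enc-dec : (c : Code) (i : Fin (size c)) → enc c (dec c i) ≡ i
  enc-dec cB fz = refl
  enc-dec cB (fs fz) = refl
  enc-dec cS fz = refl
  enc-dec cS (fs fz) = refl
  enc-dec cPh fz = refl
  enc-dec cPh (fs fz) = refl
  enc-dec cPh (fs (fs fz)) = refl
  enc-dec (c ⊗ d) i = trans (cong₂ combine (enc-dec c (proj₁ (remQuot {size c} (size d) i))) (enc-dec d (proj₂ (remQuot {size c} (size d) i))))
    (FP.combine-remQuot {size c} (size d) i)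
  enc-dec (c ⊕ d) i = trans (go (splitAt (size c) i)) (FP.join-splitAt (size c) (size d) i)
    where
    go : ∀ s → join (size c) (size d) (Data.Sum.map (enc c) (enc d) (Data.Sum.map (dec c) (dec d) s)) ≡ join (size c) (size d) s
    go (inj₁ x) = cong (λ z → join (size c) (size d) (inj₁ z)) (enc-dec c x)
    go (inj₂ y) = cong (λ z → join (size c) (size d) (inj₂ z)) (enc-dec d y)

  QE : Set
  QE = QLab × Dir × QLab

  BGraph : Graph
  BGraph = Full QLab Dir

  AGraph : Graph
  AGraph = Full Λ Gen

  cV : Code
  cV = (cB ⊗ cB) ⊕ (cS ⊗ cB ⊗ cB ⊗ cB ⊗ cPh ⊗ cB ⊗ cB)

  B2 B4 : Code
  B2 = cB ⊗ cB
  B4 = B2 ⊗ B2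

  cKind : Code
  cKind = B2 ⊕ B2 ⊕ B4 ⊕ B4 ⊕ B2 ⊕ B4 ⊕ B4 ⊕ B2

  cE : Code
  cE = (cS ⊗ cB ⊗ cB ⊗ cB) ⊗ cKind

  -- A kept vertex seaVertex x y stands for a point of the quadrant with
  -- x > 0 and y > 0 as given.  The walk simulating the quadrant edge of side σ,
  -- direction v (true: away from the axis) and endpoint data (pu , pw) passes
  -- through the vertices pathVertex σ v pu pw ph m₁ m₂, where (m₁ , m₂) are the
  -- marks of the lamplighter element it lies over.  An edge carries the same edge
  -- parameters together with the marks of its endpoints.
  SV SE : Set
  SV = ⟦ cV ⟧
  SE = ⟦ cE ⟧

  pattern seaVertex x y = inj₁ (x , y)
  pattern pathVertex σ v pu pw ph b1 b2 = inj₂ (σ , v , pu , pw , ph , b1 , b2)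

  pattern startA b1 b2 = inj₁ (b1 , b2)
  pattern startB b1 b2 = inj₂ (inj₁ (b1 , b2))
  pattern climbA b1 b2 c1 c2 = inj₂ (inj₂ (inj₁ ((b1 , b2) , (c1 , c2))))
  pattern climbB b1 b2 c1 c2 = inj₂ (inj₂ (inj₂ (inj₁ ((b1 , b2) , (c1 , c2)))))
  pattern turnEnd b1 b2 = inj₂ (inj₂ (inj₂ (inj₂ (inj₁ (b1 , b2)))))
  pattern turnDown b1 b2 c1 c2 = inj₂ (inj₂ (inj₂ (inj₂ (inj₂ (inj₁ ((b1 , b2) , (c1 , c2)))))))
  pattern descendB b1 b2 c1 c2 = inj₂ (inj₂ (inj₂ (inj₂ (inj₂ (inj₂ (inj₁ ((b1 , b2) , (c1 , c2))))))))
  pattern descendEnd b1 b2 = inj₂ (inj₂ (inj₂ (inj₂ (inj₂ (inj₂ (inj₂ (b1 , b2)))))))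

  qlabOn : Side → Bool → Bool → QLab
  qlabOn P bu bw = true , bu , true , bw
  qlabOn M bu bw = true , bw , true , bu

  dirOf : Side → Bool → Dir
  dirOf P true = goR
  dirOf P false = goL
  dirOf M true = goU
  dirOf M false = goD

  quadrantEdge : Side → Bool → Bool → Bool → QE
  quadrantEdge σ true pu pw = qlabOn σ pu pw , dirOf σ true , qlabOn σ true pw
  quadrantEdge σ false pu pw = qlabOn σ true pw , dirOf σ false , qlabOn σ pu pw

  seaVertexOn : Side → Bool → Bool → SV
  seaVertexOn P bu bw = seaVertex bu bw
  seaVertexOn M bu bw = seaVertex bw bu

  pathSource pathTarget : Side → Bool → Bool → Bool → SV
  pathSource σ true pu pw = seaVertexOn σ pu pw
  pathSource σ false pu pw = seaVertexOn σ true pw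
  pathTarget σ true pu pw = seaVertexOn σ true pw
  pathTarget σ false pu pw = seaVertexOn σ pu pw

  labelΛ : SV → Λ
  labelΛ (seaVertex x y) = (not x , not y) , sea
  labelΛ (pathVertex σ v pu pw ph b1 b2) = (b1 , b2) , run σ v

  pathSource-sea : ∀ σ v pu pw → arrow (labelΛ (pathSource σ v pu pw)) ≡ sea
  pathSource-sea P true pu pw = refl
  pathSource-sea P false pu pw = refl
  pathSource-sea M true pu pw = refl
  pathSource-sea M false pu pw = refl

  pathTarget-sea : ∀ σ v pu pw → arrow (labelΛ (pathTarget σ v pu pw)) ≡ sea
  pathTarget-sea P true pu pw = refl
  pathTarget-sea P false pu pw = refl
  pathTarget-sea M true pu pw = refl
  pathTarget-sea M false pu pw = refl

  labelQ : SV → QLab ⊎ QE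
  labelQ (seaVertex x y) = inj₁ (true , x , true , y)
  labelQ (pathVertex σ v pu pw ph b1 b2) = inj₂ (quadrantEdge σ v pu pw)

  markOf : Side → Bool → Bool → Bool
  markOf P b1 b2 = b1
  markOf M b1 b2 = b2

  -- A start edge whose validity fails is labelled as a direct edge between
  -- kept vertices; such edges never lift to the fibre product.
  startA-valid : Bool → Bool → Bool
  startA-valid true pu = true
  startA-valid false pu = pu

  startB-valid : Side → Bool → Bool → Bool → Bool → Bool
  startB-valid σ true pu b1 b2 = true
  startB-valid σ false pu b1 b2 = eqB pu (not (markOf σ b1 b2))

  srcS tgtS : SE → SV
  srcS ((σ , v , pu , pw) , startA b1 b2) = pathSource σ v pu pw
  srcS ((σ , v , pu , pw) , startB b1 b2) = pathSource σ v pu pw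
  srcS ((σ , v , pu , pw) , climbA b1 b2 c1 c2) = pathVertex σ v pu pw climbing b1 b2
  srcS ((σ , v , pu , pw) , climbB b1 b2 c1 c2) = pathVertex σ v pu pw climbing b1 b2
  srcS ((σ , v , pu , pw) , turnEnd b1 b2) = pathVertex σ v pu pw turning b1 b2
  srcS ((σ , v , pu , pw) , turnDown b1 b2 c1 c2) = pathVertex σ v pu pw turning b1 b2
  srcS ((σ , v , pu , pw) , descendB b1 b2 c1 c2) = pathVertex σ v pu pw descending b1 b2
  srcS ((σ , v , pu , pw) , descendEnd b1 b2) = pathVertex σ v pu pw descending b1 b2
  tgtS ((σ , v , pu , pw) , startA b1 b2) = if startA-valid v pu then pathVertex σ v pu pw climbing b1 b2 else pathTarget σ v pu pw
  tgtS ((σ , v , pu , pw) , startB b1 b2) = if startB-valid σ v pu b1 b2 then pathVertex σ v pu pw turning b1 b2 else pathTarget σ v pu pw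
  tgtS ((σ , v , pu , pw) , climbA b1 b2 c1 c2) = pathVertex σ v pu pw climbing c1 c2
  tgtS ((σ , v , pu , pw) , climbB b1 b2 c1 c2) = pathVertex σ v pu pw turning c1 c2
  tgtS ((σ , v , pu , pw) , turnEnd b1 b2) = pathTarget σ v pu pw
  tgtS ((σ , v , pu , pw) , turnDown b1 b2 c1 c2) = pathVertex σ v pu pw descending c1 c2
  tgtS ((σ , v , pu , pw) , descendB b1 b2 c1 c2) = pathVertex σ v pu pw descending c1 c2
  tgtS ((σ , v , pu , pw) , descendEnd b1 b2) = pathTarget σ v pu pw

  genOf : SE → Gen
  genOf ((σ , _) , startA _ _) = upA σ
  genOf ((σ , _) , startB _ _) = upB σ
  genOf ((σ , _) , climbA _ _ _ _) = upA σ
  genOf ((σ , _) , climbB _ _ _ _) = upB σ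
  genOf ((σ , _) , turnEnd _ _) = downA σ
  genOf ((σ , _) , turnDown _ _ _ _) = downA σ
  genOf ((σ , _) , descendB _ _ _ _) = downB σ
  genOf ((σ , _) , descendEnd _ _) = downB σ

  labelQE : SE → Bool × QE × Bool
  labelQE ((σ , v , pu , pw) , startA _ _) = false , quadrantEdge σ v pu pw , startA-valid v pu
  labelQE ((σ , v , pu , pw) , startB b1 b2) = false , quadrantEdge σ v pu pw , startB-valid σ v pu b1 b2
  labelQE ((σ , v , pu , pw) , climbA _ _ _ _) = true , quadrantEdge σ v pu pw , true
  labelQE ((σ , v , pu , pw) , climbB _ _ _ _) = true , quadrantEdge σ v pu pw , true
  labelQE ((σ , v , pu , pw) , turnEnd _ _) = true , quadrantEdge σ v pu pw , false
  labelQE ((σ , v , pu , pw) , turnDown _ _ _ _) = true , quadrantEdge σ v pu pw , true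
  labelQE ((σ , v , pu , pw) , descendB _ _ _ _) = true , quadrantEdge σ v pu pw , true
  labelQE ((σ , v , pu , pw) , descendEnd _ _) = true , quadrantEdge σ v pu pw , false

  srcB-ok : ∀ e → labelQ (srcS e) ≡ subSrc BGraph (labelQE e)
  srcB-ok ((P , true , pu , pw) , startA _ _) = refl
  srcB-ok ((P , false , pu , pw) , startA _ _) = refl
  srcB-ok ((M , true , pu , pw) , startA _ _) = refl
  srcB-ok ((M , false , pu , pw) , startA _ _) = refl
  srcB-ok ((P , true , pu , pw) , startB _ _) = refl
  srcB-ok ((P , false , pu , pw) , startB _ _) = refl
  srcB-ok ((M , true , pu , pw) , startB _ _) = refl
  srcB-ok ((M , false , pu , pw) , startB _ _) = refl
  srcB-ok ((σ , v , pu , pw) , climbA _ _ _ _) = refl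
  srcB-ok ((σ , v , pu , pw) , climbB _ _ _ _) = refl
  srcB-ok ((σ , v , pu , pw) , turnEnd _ _) = refl
  srcB-ok ((σ , v , pu , pw) , turnDown _ _ _ _) = refl
  srcB-ok ((σ , v , pu , pw) , descendB _ _ _ _) = refl
  srcB-ok ((σ , v , pu , pw) , descendEnd _ _) = refl

  tgtB-ok : ∀ e → labelQ (tgtS e) ≡ subTgt BGraph (labelQE e)
  tgtB-ok ((σ , true , pu , pw) , startA _ _) = refl
  tgtB-ok ((σ , false , true , pw) , startA _ _) = refl
  tgtB-ok ((P , false , false , pw) , startA _ _) = refl
  tgtB-ok ((M , false , false , pw) , startA _ _) = refl
  tgtB-ok ((σ , true , pu , pw) , startB _ _) = refl
  tgtB-ok ((σ , false , pu , pw) , startB b1 b2) with eqB pu (not (markOf σ b1 b2))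
  tgtB-ok ((σ , false , pu , pw) , startB b1 b2) | true = refl
  tgtB-ok ((P , false , pu , pw) , startB b1 b2) | false = refl
  tgtB-ok ((M , false , pu , pw) , startB b1 b2) | false = refl
  tgtB-ok ((σ , v , pu , pw) , climbA _ _ _ _) = refl
  tgtB-ok ((σ , v , pu , pw) , climbB _ _ _ _) = refl
  tgtB-ok ((P , true , pu , pw) , turnEnd _ _) = refl
  tgtB-ok ((P , false , pu , pw) , turnEnd _ _) = refl
  tgtB-ok ((M , true , pu , pw) , turnEnd _ _) = refl
  tgtB-ok ((M , false , pu , pw) , turnEnd _ _) = refl
  tgtB-ok ((σ , v , pu , pw) , turnDown _ _ _ _) = refl
  tgtB-ok ((σ , v , pu , pw) , descendB _ _ _ _) = refl
  tgtB-ok ((P , true , pu , pw) , descendEnd _ _) = refl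
  tgtB-ok ((P , false , pu , pw) , descendEnd _ _) = refl
  tgtB-ok ((M , true , pu , pw) , descendEnd _ _) = refl
  tgtB-ok ((M , false , pu , pw) , descendEnd _ _) = refl

  -- Kept abstract so that type checking never unfolds the Fin arithmetic.
  abstract
    encV : SV → Fin (size cV)
    encV = enc cV
    decV : Fin (size cV) → SV
    decV = dec cV
    encE : SE → Fin (size cE)
    encE = enc cE
    decE : Fin (size cE) → SE
    decE = dec cE
    dec-encV : ∀ x → decV (encV x) ≡ x
    dec-encV = dec-enc cV
    enc-decV : ∀ i → encV (decV i) ≡ i
    enc-decV = enc-dec cV
    dec-encE : ∀ x → decE (encE x) ≡ x
    dec-encE = dec-enc cE
    enc-decE : ∀ i → encE (decE i) ≡ i
    enc-decE = enc-dec cE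

  labelΛE : SE → Λ × Gen × Λ
  labelΛE e = labelΛ (srcS e) , genOf e , labelΛ (tgtS e)

  simulator : FinSimulator AGraph BGraph
  simulator = record
    { nV = size cV
    ; nE = size cE
    ; ssrc = λ f → encV (srcS (decE f))
    ; stgt = λ f → encV (tgtS (decE f))
    ; toA = record
      { vmap = λ v → labelΛ (decV v)
      ; emap = λ f → labelΛE (decE f)
      ; src-comm = λ f → cong labelΛ (dec-encV (srcS (decE f)))
      ; tgt-comm = λ f → cong labelΛ (dec-encV (tgtS (decE f)))
      }
    ; toB = record
      { vmap = λ v → labelQ (decV v)
      ; emap = λ f → labelQE (decE f)
      ; src-comm = λ f → trans (cong labelQ (dec-encV (srcS (decE f)))) (srcB-ok (decE f))
      ; tgt-comm = λ f → trans (cong labelQ (dec-encV (tgtS (decE f)))) (tgtB-ok (decE f))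
      }
    }

module VertexBijection where

  open Binary
  open Halves
  open LocalRules
  open Characterisation
  open Simulator
  open import Data.Nat as N using (ℕ; zero; suc; z≤n)
  open import Data.Integer as Z using (+_)
  open import Data.Bool using (Bool; true; false; not)
  import Data.Bool.Properties as BP
  open import Data.Product using (_×_; _,_; proj₁; proj₂)
  import Data.Product.Properties as PP
  open import Data.Sum using (_⊎_)
  import Data.Sum.Properties as SP
  open import Data.Empty using (⊥-elim)
  import Data.Fin.Properties as FP
  open import Relation.Binary.PropositionalEquality
  open import Relation.Binary.Definitions using (DecidableEquality)
  open import Relation.Nullary.Decidable using (map′)
  open import Axiom.UniquenessOfIdentityProofs using (UIP; module Decidable⇒UIP)
  open import Function.Bundles using (_↔_; mk↔ₛ′)

  codeG : Gen → ℕ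
  codeG a = 0
  codeG a⁻¹ = 1
  codeG b = 2
  codeG b⁻¹ = 3

  genOfCode : ℕ → Gen
  genOfCode 0 = a
  genOfCode 1 = a⁻¹
  genOfCode 2 = b
  genOfCode _ = b⁻¹

  genOfCode-codeG : ∀ x → genOfCode (codeG x) ≡ x
  genOfCode-codeG a = refl
  genOfCode-codeG a⁻¹ = refl
  genOfCode-codeG b = refl
  genOfCode-codeG b⁻¹ = refl

  _≟G_ : DecidableEquality Gen
  _≟G_ = retract-≟ codeG genOfCode genOfCode-codeG

  codeD : Dir → ℕ
  codeD goR = 0
  codeD goL = 1
  codeD goU = 2
  codeD goD = 3

  dirOfCode : ℕ → Dir
  dirOfCode 0 = goR
  dirOfCode 1 = goL
  dirOfCode 2 = goU
  dirOfCode _ = goD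

  dirOfCode-codeD : ∀ x → dirOfCode (codeD x) ≡ x
  dirOfCode-codeD goR = refl
  dirOfCode-codeD goL = refl
  dirOfCode-codeD goU = refl
  dirOfCode-codeD goD = refl

  _≟D_ : DecidableEquality Dir
  _≟D_ = retract-≟ codeD dirOfCode dirOfCode-codeD

  _≟B_ : DecidableEquality Bool
  _≟B_ = BP._≟_

  _×-≟_ : {A B : Set} → DecidableEquality A → DecidableEquality B → DecidableEquality (A × B)
  (d1 ×-≟ d2) = PP.≡-dec d1 d2

  _≟Λ_ : DecidableEquality Λ
  _≟Λ_ = (_≟B_ ×-≟ _≟B_) ×-≟ _≟A_

  _≟Q_ : DecidableEquality QLab
  _≟Q_ = _≟B_ ×-≟ (_≟B_ ×-≟ (_≟B_ ×-≟ _≟B_))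

  _≟QE_ : DecidableEquality QE
  _≟QE_ = _≟Q_ ×-≟ (_≟D_ ×-≟ _≟Q_)

  uipΛ : UIP Λ
  uipΛ = Decidable⇒UIP.≡-irrelevant _≟Λ_

  uipLV : UIP (QLab ⊎ QE)
  uipLV = Decidable⇒UIP.≡-irrelevant (SP.≡-dec _≟Q_ _≟QE_)

  uipLE : UIP (Bool × QE × Bool)
  uipLE = Decidable⇒UIP.≡-irrelevant (_≟B_ ×-≟ (_≟QE_ ×-≟ _≟B_))

  uipAE : UIP (Λ × Gen × Λ)
  uipAE = Decidable⇒UIP.≡-irrelevant (_≟Λ_ ×-≟ (_≟G_ ×-≟ _≟Λ_))

  module Vertices (η : Lamp → Λ) (h : InΩ η) (h1 : η one ≡ ((true , true) , sea)) where
    open Labels η h h1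
    open Simulation (cayley η) simulator

    _≟L_ : DecidableEquality Lamp
    _≟L_ = N._≟_ ×-≟ Z._≟_

    FV-≡ : (x y : FV) → proj₁ x ≡ proj₁ y → x ≡ y
    FV-≡ (p , q) (.p , q') refl = cong (p ,_) (uipΛ q q')

    _≟FV_ : DecidableEquality FV
    x ≟FV y = map′ (FV-≡ x y) (cong proj₁) ((_≟L_ ×-≟ FP._≟_) (proj₁ x) (proj₁ y))

    uipFV : UIP FV
    uipFV = Decidable⇒UIP.≡-irrelevant _≟FV_

    FE-≡ : (x y : FE) → proj₁ x ≡ proj₁ y → x ≡ y
    FE-≡ (p , q) (.p , q') refl = cong (p ,_) (uipAE q q')

    SimV-≡ : (v v' : SimV) → proj₁ (proj₁ v) ≡ proj₁ (proj₁ v') → proj₁ (proj₂ v) ≡ proj₁ (proj₂ v') → v ≡ v'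
    SimV-≡ (x , bb , q) (x' , .bb , q') e refl with FV-≡ x x' e
    ... | refl = cong (λ z → x , bb , z) (uipLV q q')

    mark-seaLevel : ∀ σ u w → mark σ (η (point σ (u , w) 0)) ≡ not (pos? u)
    mark-seaLevel σ zero w = mark-if-small σ w 0 0 (λ k _ → testBit-0 k)
    mark-seaLevel σ (suc u) w with mark σ (η (point σ (suc u , w) 0)) in eq
    ... | false = refl
    ... | true with bits-false⇒≡0 (suc u) (λ k → mark-only-if-small σ (suc u) w 0 eq k z≤n)
    ...   | ()

    η-seaLevel : ∀ x y → η (interleave x y , + 0) ≡ ((not (pos? x) , not (pos? y)) , sea)
    η-seaLevel x y = cong₂ _,_ (cong₂ _,_ (mark-seaLevel P x y) (mark-seaLevel M y x)) (seaLevel (interleave x y))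

    toVertex : ℕ × ℕ → SimV
    toVertex (x , y) = (((interleave x y , + 0) , encV (seaVertex (pos? x) (pos? y))) , trans (η-seaLevel x y) (cong labelΛ (sym (dec-encV (seaVertex (pos? x) (pos? y)))))) ,
                  (true , pos? x , true , pos? y) , cong labelQ (dec-encV (seaVertex (pos? x) (pos? y)))

    fromVertex : SimV → ℕ × ℕ
    fromVertex v = evens (proj₁ (proj₁ (proj₁ (proj₁ v)))) , odds (proj₁ (proj₁ (proj₁ (proj₁ v))))

    fromVertex-toVertex : ∀ p → fromVertex (toVertex p) ≡ p
    fromVertex-toVertex (x , y) = cong₂ _,_ (evens-interleave x y) (odds-interleave x y)

    sea⇒level0 : ∀ s n → arrow (η (s , n)) ≡ sea → n ≡ + 0
    sea⇒level0 s n e with position P (s , n)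
    ... | own c zero = refl
    ... | own c (suc j) = ⊥-elim (aboveSea P c j e)
    ... | other c j = ⊥-elim (aboveSea M c j e)

    toVertex-fromVertex : ∀ v → toVertex (fromVertex v) ≡ v
    toVertex-fromVertex v@((((s , n) , i) , pf) , bl , q) = go (decV i) refl
      where
      go : ∀ d → decV i ≡ d → toVertex (fromVertex v) ≡ v
      go (pathVertex _ _ _ _ _ _ _) e with trans (sym (cong labelQ e)) q
      ... | ()
      go (seaVertex x0 y0) e = sym (SimV-≡ v (toVertex (fromVertex v)) (cong₂ _,_ (cong₂ _,_ (sym (interleave-split s)) n0) fin) bq)
        where
        pf' : η (s , n) ≡ ((not x0 , not y0) , sea)
        pf' = trans pf (cong labelΛ e)
        n0 : n ≡ + 0
        n0 = sea⇒level0 s n (cong arrow pf')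
        pf'' : η (interleave (evens s) (odds s) , + 0) ≡ ((not x0 , not y0) , sea)
        pf'' = trans (cong η (cong₂ _,_ (interleave-split s) (sym n0))) pf'
        ee = trans (sym pf'') (η-seaLevel (evens s) (odds s))
        x0e : x0 ≡ pos? (evens s)
        x0e = BP.not-injective (cong (λ l → proj₁ (proj₁ l)) ee)
        y0e : y0 ≡ pos? (odds s)
        y0e = BP.not-injective (cong (λ l → proj₂ (proj₁ l)) ee)
        fin : i ≡ encV (seaVertex (pos? (evens s)) (pos? (odds s)))
        fin = trans (sym (enc-decV i)) (cong encV (trans e (cong₂ seaVertex x0e y0e)))
        bq : bl ≡ (true , pos? (evens s) , true , pos? (odds s))
        bq = trans (SP.inj₁-injective (trans (sym q) (cong labelQ e))) (cong₂ (λ p r → true , p , true , r) x0e y0e)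

    vbij : (ℕ × ℕ) ↔ SimV
    vbij = mk↔ₛ′ toVertex fromVertex toVertex-fromVertex fromVertex-toVertex


module SimulatedPaths where

  open Binary
  open Halves
  open LocalRules
  open Characterisation
  open Simulator
  open VertexBijection
  open import Data.Nat as N using (ℕ; zero; suc; _≤_; _<_; z≤n; s≤s)
  import Data.Nat.Properties as NP
  open import Data.Integer using (+_)
  open import Data.Bool using (Bool; true; false; not; if_then_else_)
  import Data.Bool.Properties as BP
  open import Data.Product using (Σ; _×_; _,_; proj₁; proj₂)
  open import Data.Sum using (_⊎_; inj₁; inj₂)
  open import Data.Empty using (⊥; ⊥-elim)
  open import Relation.Binary.PropositionalEquality
  open import Relation.Nullary using (yes; no)

  module Paths (η : Lamp → Λ) (h : InΩ η) (h1 : η one ≡ ((true , true) , sea)) where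
    open Vertices η h h1
    open Labels η h h1
    open Simulation (cayley η) simulator

    η-pathVertex : ∀ g σ v pu pw ph → arrow (η g) ≡ run σ v → η g ≡ labelΛ (pathVertex σ v pu pw ph (proj₁ (proj₁ (η g))) (proj₂ (proj₁ (η g))))
    η-pathVertex g σ v pu pw ph e = cong (proj₁ (η g) ,_) e

    arrow-run : ∀ σ v u w j → LowBits v u (suc j) → arrow (η (point σ (u , w) (suc j))) ≡ run σ v
    arrow-run σ v u w j hb = trans (arrow-predicted σ u w (suc j)) (predictedArrow-run σ v u j (testBit⇒lowBits v u (suc j) hb))

    fibreEdge : (g : Lamp) (e : SE) → η g ≡ labelΛ (srcS e) → η (g · genOf e) ≡ labelΛ (tgtS e) → FE
    fibreEdge g e p1 p2 = ((g , genOf e) , encE e) ,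
      trans (cong₂ (λ x y → x , genOf e , y) p1 p2) (cong labelΛE (sym (dec-encE e)))

    fsrc-fibreEdge : ∀ g e p1 p2 → proj₁ (fsrc (fibreEdge g e p1 p2)) ≡ (g , encV (srcS e))
    fsrc-fibreEdge g e p1 p2 = cong (λ z → g , encV (srcS z)) (dec-encE e)

    ftgt-fibreEdge : ∀ g e p1 p2 → proj₁ (ftgt (fibreEdge g e p1 p2)) ≡ (g · genOf e , encV (tgtS e))
    ftgt-fibreEdge g e p1 p2 = cong (λ z → g · genOf e , encV (tgtS z)) (dec-encE e)

    labE-fibreEdge : ∀ g e p1 p2 → labE (fibreEdge g e p1 p2) ≡ labelQE e
    labE-fibreEdge g e p1 p2 = cong labelQE (dec-encE e)

    tailEnd-subst : ∀ {c x x'} (q : x ≡ x') (t : Tail c x) → tailEnd (subst (Tail c) q t) ≡ tailEnd t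
    tailEnd-subst refl t = refl

    module Build (σ : Side) (v pu pw : Bool) (w uend : ℕ)
                 (hend : η (point σ (uend , w) 0) ≡ labelΛ (pathTarget σ v pu pw)) where

      c : QE
      c = quadrantEdge σ v pu pw

      EndsAtTarget : ∀ {x} → Tail c x → Set
      EndsAtTarget t = proj₁ (proj₁ (tailEnd t)) ≡ (point σ (uend , w) 0 , encV (pathTarget σ v pu pw))

      TailsFrom : Lamp → SV → Set
      TailsFrom g sv = ∀ (x : FV) → proj₁ x ≡ (g , encV sv) → Σ (Tail c x) EndsAtTarget

      edgeParams : Side × Bool × Bool × Bool
      edgeParams = σ , v , pu , pw

      marks : Lamp → Bool × Bool
      marks g = proj₁ (η g)

      pathVertexAt : Phase → Lamp → SV
      pathVertexAt ph g = pathVertex σ v pu pw ph (proj₁ (marks g)) (proj₂ (marks g))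

      tail-stop : ∀ g e (p1 : η g ≡ labelΛ (srcS e)) (p2 : η (g · genOf e) ≡ labelΛ (tgtS e)) → labelQE e ≡ (true , c , false) →
              g · genOf e ≡ point σ (uend , w) 0 → tgtS e ≡ pathTarget σ v pu pw → TailsFrom g (srcS e)
      tail-stop g e p1 p2 lb eg et x ex =
        subst (Tail c) q (stop p (trans (labE-fibreEdge g e p1 p2) lb)) ,
        trans (cong (λ z → proj₁ (proj₁ z)) (tailEnd-subst q (stop p (trans (labE-fibreEdge g e p1 p2) lb))))
              (trans (ftgt-fibreEdge g e p1 p2) (cong₂ _,_ eg (cong encV et)))
        where
        p = fibreEdge g e p1 p2
        q : fsrc p ≡ x
        q = FV-≡ _ _ (trans (fsrc-fibreEdge g e p1 p2) (sym ex))

      tail-loop : ∀ g e (p1 : η g ≡ labelΛ (srcS e)) (p2 : η (g · genOf e) ≡ labelΛ (tgtS e)) → labelQE e ≡ (true , c , true) →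
              TailsFrom (g · genOf e) (tgtS e) → TailsFrom g (srcS e)
      tail-loop g e p1 p2 lb rest x ex =
        subst (Tail c) q (loop p (trans (labE-fibreEdge g e p1 p2) lb) (proj₁ r)) ,
        trans (cong (λ z → proj₁ (proj₁ z)) (tailEnd-subst q (loop p (trans (labE-fibreEdge g e p1 p2) lb) (proj₁ r)))) (proj₂ r)
        where
        p = fibreEdge g e p1 p2
        q : fsrc p ≡ x
        q = FV-≡ _ _ (trans (fsrc-fibreEdge g e p1 p2) (sym ex))
        r = rest (ftgt p) (ftgt-fibreEdge g e p1 p2)

      TailsFrom-subst : ∀ {g g'} sv → g ≡ g' → TailsFrom g sv → TailsFrom g' sv
      TailsFrom-subst sv refl bb = bb

      descendPath : ∀ i z → LowBits v z (suc i) → flipBitsBelow z (suc i) ≡ uend →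
            TailsFrom (point σ (z , w) (suc i)) (pathVertexAt descending (point σ (z , w) (suc i)))
      descendPath zero z hb fe = tail-stop g e (η-pathVertex g σ v pu pw descending (arrow-run σ v z w 0 hb)) p2 refl eg refl
        where
        g = point σ (z , w) 1
        e : SE
        e = edgeParams , descendEnd (proj₁ (marks g)) (proj₂ (marks g))
        eg : g · genOf e ≡ point σ (uend , w) 0
        eg = trans (point-downB σ (z , w) 0) (cong (λ u → point σ (u , w) 0) fe)
        p2 : η (g · genOf e) ≡ labelΛ (tgtS e)
        p2 = trans (cong η eg) hend
      descendPath (suc i) z hb fe = tail-loop g e (η-pathVertex g σ v pu pw descending (arrow-run σ v z w (suc i) hb)) p2 refl
        (TailsFrom-subst (tgtS e) (sym eg) (descendPath i (flipBit z (suc i)) hb' fe))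
        where
        g = point σ (z , w) (suc (suc i))
        g' = point σ (flipBit z (suc i) , w) (suc i)
        e : SE
        e = edgeParams , descendB (proj₁ (marks g)) (proj₂ (marks g)) (proj₁ (marks g')) (proj₂ (marks g'))
        eg : g · genOf e ≡ g'
        eg = point-downB σ (z , w) (suc i)
        hb' : ∀ k → k < suc i → testBit (flipBit z (suc i)) k ≡ v
        hb' k lt = trans (testBit-flipBit-other (suc i) k z (λ e' → NP.<-irrefl (sym e') lt)) (hb k (NP.m≤n⇒m≤1+n lt))
        p2 : η (g · genOf e) ≡ labelΛ (tgtS e)
        p2 = trans (cong η eg) (η-pathVertex g' σ v pu pw descending (arrow-run σ v (flipBit z (suc i)) w i hb'))

      turnPath : ∀ j z → LowBits v z (suc j) → flipBitsBelow z j ≡ uend →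
             TailsFrom (point σ (z , w) (suc j)) (pathVertexAt turning (point σ (z , w) (suc j)))
      turnPath zero z hb fe = tail-stop g e (η-pathVertex g σ v pu pw turning (arrow-run σ v z w 0 hb)) p2 refl eg refl
        where
        g = point σ (z , w) 1
        e : SE
        e = edgeParams , turnEnd (proj₁ (marks g)) (proj₂ (marks g))
        eg : g · genOf e ≡ point σ (uend , w) 0
        eg = trans (point-downA σ (z , w) 0) (cong (λ u → point σ (u , w) 0) fe)
        p2 : η (g · genOf e) ≡ labelΛ (tgtS e)
        p2 = trans (cong η eg) hend
      turnPath (suc j) z hb fe = tail-loop g e (η-pathVertex g σ v pu pw turning (arrow-run σ v z w (suc j) hb)) p2 refl
        (TailsFrom-subst (tgtS e) (sym eg) (descendPath j z (λ k lt → hb k (NP.m≤n⇒m≤1+n lt)) fe))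
        where
        g = point σ (z , w) (suc (suc j))
        g' = point σ (z , w) (suc j)
        e : SE
        e = edgeParams , turnDown (proj₁ (marks g)) (proj₂ (marks g)) (proj₁ (marks g')) (proj₂ (marks g'))
        eg : g · genOf e ≡ g'
        eg = point-downA σ (z , w) (suc j)
        p2 : η (g · genOf e) ≡ labelΛ (tgtS e)
        p2 = trans (cong η eg) (η-pathVertex g' σ v pu pw descending (arrow-run σ v z w j (λ k lt → hb k (NP.m≤n⇒m≤1+n lt))))

      climbPath : ∀ t u → LowBits v u t → testBit u t ≡ not v → flipBitsBelow (flipBit u t) t ≡ uend →
                  ∀ d j → d N.+ suc j ≡ t → TailsFrom (point σ (u , w) (suc j)) (pathVertexAt climbing (point σ (u , w) (suc j)))
      climbPath t u hb ht fe zero j refl = tail-loop g e (η-pathVertex g σ v pu pw climbing (arrow-run σ v u w j hb)) p2 refl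
        (TailsFrom-subst (tgtS e) (sym eg) (turnPath (suc j) (flipBit u (suc j)) hz fe))
        where
        hz = LowBits-flipBit v u (suc j) hb ht
        g = point σ (u , w) (suc j)
        g' = point σ (flipBit u (suc j) , w) (suc (suc j))
        e : SE
        e = edgeParams , climbB (proj₁ (marks g)) (proj₂ (marks g)) (proj₁ (marks g')) (proj₂ (marks g'))
        eg : g · genOf e ≡ g'
        eg = point-upB σ (u , w) (suc j)
        p2 : η (g · genOf e) ≡ labelΛ (tgtS e)
        p2 = trans (cong η eg) (η-pathVertex g' σ v pu pw turning (arrow-run σ v (flipBit u (suc j)) w (suc j) hz))
      climbPath t u hb ht fe (suc d) j sum≡t = tail-loop g e (η-pathVertex g σ v pu pw climbing (arrow-run σ v u w j below)) p2 refl
        (TailsFrom-subst (tgtS e) (sym eg) (climbPath t u hb ht fe d (suc j) (trans (NP.+-suc d (suc j)) sum≡t)))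
        where
        below : LowBits v u (suc j)
        below = LowBits-≤ (subst (suc j ≤_) sum≡t (NP.m≤n+m (suc j) (suc d))) hb
        below′ : LowBits v u (suc (suc j))
        below′ = LowBits-≤ (subst (suc (suc j) ≤_) (trans (NP.+-suc d (suc j)) sum≡t) (NP.m≤n+m (suc (suc j)) d)) hb
        g = point σ (u , w) (suc j)
        g' = point σ (u , w) (suc (suc j))
        e : SE
        e = edgeParams , climbA (proj₁ (marks g)) (proj₂ (marks g)) (proj₁ (marks g')) (proj₂ (marks g'))
        eg : g · genOf e ≡ g'
        eg = point-upA σ (u , w) (suc j)
        p2 : η (g · genOf e) ≡ labelΛ (tgtS e)
        p2 = trans (cong η eg) (η-pathVertex g' σ v pu pw climbing (arrow-run σ v u w (suc j) below′))

      module Start (u t : ℕ) (hb : LowBits v u t) (ht : testBit u t ≡ not v)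
                   (fe : flipBitsBelow (flipBit u t) t ≡ uend)
                   (hsrc : η (point σ (u , w) 0) ≡ labelΛ (pathSource σ v pu pw)) where

        g0 g1 : Lamp
        g0 = point σ (u , w) 0
        g1 = point σ (flipBit u 0 , w) 1

        Spec : SimE → Set
        Spec sx = (proj₁ (proj₁ (simSrc sx)) ≡ (g0 , encV (pathSource σ v pu pw))) ×
                  (proj₁ (proj₁ (simTgt sx)) ≡ (point σ (uend , w) 0 , encV (pathTarget σ v pu pw))) ×
                  (simLabE sx ≡ c)

        startEdge : ∀ (e : SE) (p2 : η (g0 · genOf e) ≡ labelΛ (tgtS e)) → srcS e ≡ pathSource σ v pu pw → labelQE e ≡ (false , c , true) →
               TailsFrom (g0 · genOf e) (tgtS e) → Σ SimE Spec
        startEdge e p2 es lb rest = via c p (trans (labE-fibreEdge g0 e p1 p2) lb) (proj₁ r) ,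
                               trans (fsrc-fibreEdge g0 e p1 p2) (cong (λ z → g0 , encV z) es) , proj₂ r , refl
          where
          p1 : η g0 ≡ labelΛ (srcS e)
          p1 = trans hsrc (cong labelΛ (sym es))
          p = fibreEdge g0 e p1 p2
          r = rest (ftgt p) (ftgt-fibreEdge g0 e p1 p2)

        startFlip : t ≡ 0 → startB-valid σ v pu (proj₁ (marks g1)) (proj₂ (marks g1)) ≡ true → Σ SimE Spec
        startFlip refl valid = startEdge e p2 refl lb (TailsFrom-subst (tgtS e) (sym eg) (subst (TailsFrom g1) (sym te) (turnPath 0 (flipBit u 0) hz fe)))
          where
          e : SE
          e = edgeParams , startB (proj₁ (marks g1)) (proj₂ (marks g1))
          hz = LowBits-flipBit v u 0 hb ht
          te : tgtS e ≡ pathVertexAt turning g1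
          te = cong (λ z → if z then pathVertex σ v pu pw turning (proj₁ (marks g1)) (proj₂ (marks g1)) else pathTarget σ v pu pw) valid
          eg : g0 · genOf e ≡ g1
          eg = point-upB σ (u , w) 0
          p2 : η (g0 · genOf e) ≡ labelΛ (tgtS e)
          p2 = trans (cong η eg) (trans (η-pathVertex g1 σ v pu pw turning (arrow-run σ v (flipBit u 0) w 0 hz)) (cong labelΛ (sym te)))
          lb : labelQE e ≡ (false , c , true)
          lb = cong (λ z → false , c , z) valid

        startClimb : ∀ t' → t ≡ suc t' → startA-valid v pu ≡ true → Σ SimE Spec
        startClimb t' refl valid = startEdge e p2 refl lb (TailsFrom-subst (tgtS e) (sym eg) (subst (TailsFrom g) (sym te) (climbPath t u hb ht fe t' 0 (NP.+-comm t' 1))))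
          where
          g = point σ (u , w) 1
          e : SE
          e = edgeParams , startA (proj₁ (marks g)) (proj₂ (marks g))
          te : tgtS e ≡ pathVertexAt climbing g
          te = cong (λ z → if z then pathVertex σ v pu pw climbing (proj₁ (marks g)) (proj₂ (marks g)) else pathTarget σ v pu pw) valid
          eg : g0 · genOf e ≡ g
          eg = point-upA σ (u , w) 0
          p2 : η (g0 · genOf e) ≡ labelΛ (tgtS e)
          p2 = trans (cong η eg) (trans (η-pathVertex g σ v pu pw climbing (arrow-run σ v u w 0 (λ k lt → hb k (NP.<-≤-trans lt (s≤s z≤n))))) (cong labelΛ (sym te)))
          lb : labelQE e ≡ (false , c , true)
          lb = cong (λ z → false , c , z) valid

    η-seaLevelOn : ∀ σ u w → η (point σ (u , w) 0) ≡ labelΛ (seaVertexOn σ (pos? u) (pos? w))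
    η-seaLevelOn P u w = η-seaLevel u w
    η-seaLevelOn M u w = η-seaLevel w u

    markOf-mark : ∀ σ (l : Λ) → markOf σ (proj₁ (proj₁ l)) (proj₂ (proj₁ l)) ≡ mark σ l
    markOf-mark P l = refl
    markOf-mark M l = refl

    mark-level1 : ∀ σ x w → testBit x 0 ≡ false → mark σ (η (point σ (x , w) 1)) ≡ not (pos? x)
    mark-level1 σ zero w _ = mark-if-small σ w 1 0 (λ k _ → testBit-0 k)
    mark-level1 σ (suc x) w b0 with mark σ (η (point σ (suc x , w) 1)) in eq
    ... | false = refl
    ... | true with bits-false⇒≡0 (suc x) allz
      where
      allz : ∀ k → testBit (suc x) k ≡ false
      allz zero = b0
      allz (suc k) = mark-only-if-small σ (suc x) w 1 eq (suc k) (s≤s z≤n)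
    ... | ()

    PathSpec : Side → Bool → Bool → Bool → ℕ → ℕ → ℕ → SimE → Set
    PathSpec σ v pu pw w u uend sx =
      (proj₁ (proj₁ (simSrc sx)) ≡ (point σ (u , w) 0 , encV (pathSource σ v pu pw))) ×
      (proj₁ (proj₁ (simTgt sx)) ≡ (point σ (uend , w) 0 , encV (pathTarget σ v pu pw))) ×
      (simLabE sx ≡ quadrantEdge σ v pu pw)

    incrementEdge : ∀ σ u w → Σ SimE (PathSpec σ true (pos? u) (pos? w) w u (suc u))
    incrementEdge σ u w = go (proj₁ ef) refl
      where
      ef = first-bit-≢ true u u (testBit-≥ u u NP.≤-refl)
      open Build σ true (pos? u) (pos? w) w (suc u) (η-seaLevelOn σ (suc u) w)
      go : ∀ t → proj₁ ef ≡ t → Σ SimE (PathSpec σ true (pos? u) (pos? w) w u (suc u))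
      go zero e = Start.startFlip u 0 hb ht (carry-suc u 0 hb ht) (η-seaLevelOn σ u w) refl refl
        where
        hb = subst (λ t → LowBits true u t) e (proj₁ (proj₂ ef))
        ht = subst (λ t → testBit u t ≡ false) e (proj₂ (proj₂ ef))
      go (suc t') e = Start.startClimb u (suc t') hb ht (carry-suc u (suc t') hb ht) (η-seaLevelOn σ u w) t' refl refl
        where
        hb = subst (λ t → LowBits true u t) e (proj₁ (proj₂ ef))
        ht = subst (λ t → testBit u t ≡ false) e (proj₂ (proj₂ ef))

    decrementEdge : ∀ σ x w → Σ SimE (PathSpec σ false (pos? x) (pos? w) w (suc x) x)
    decrementEdge σ x w = go (proj₁ ef) refl
      where
      nb = suc-has-bit x
      ef = first-bit-≢ false (suc x) (proj₁ nb) (proj₂ nb)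
      open Build σ false (pos? x) (pos? w) w x (η-seaLevelOn σ x w)
      go : ∀ t → proj₁ ef ≡ t → Σ SimE (PathSpec σ false (pos? x) (pos? w) w (suc x) x)
      go zero e = Start.startFlip (suc x) 0 hb ht (carry-pred x 0 hb ht) (η-seaLevelOn σ (suc x) w) refl hv
        where
        hb = subst (λ t → LowBits false (suc x) t) e (proj₁ (proj₂ ef))
        ht = subst (λ t → testBit (suc x) t ≡ true) e (proj₂ (proj₂ ef))
        bx : testBit x 0 ≡ false
        bx = trans (sym (BP.not-involutive (isOdd x))) (cong not ht)
        hv : startB-valid σ false (pos? x) (proj₁ (proj₁ (η (point σ (flipBit (suc x) 0 , w) 1)))) (proj₂ (proj₁ (η (point σ (flipBit (suc x) 0 , w) 1)))) ≡ true
        hv = trans (cong (λ z → eqB (pos? x) (not z)) (trans (markOf-mark σ (η (point σ (flipBit (suc x) 0 , w) 1)))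
                     (trans (cong (λ z → mark σ (η (point σ (z , w) 1))) (suc-flipBit-0 x ht)) (mark-level1 σ x w bx))))
                   (trans (cong (eqB (pos? x)) (BP.not-involutive (pos? x))) (eqB-refl (pos? x)))
      go (suc t') e = Start.startClimb (suc x) (suc t') hb ht (carry-pred x (suc t') hb ht) (η-seaLevelOn σ (suc x) w) t' refl (hv x (hb 0 (s≤s z≤n)))
        where
        hb = subst (λ t → LowBits false (suc x) t) e (proj₁ (proj₂ ef))
        ht = subst (λ t → testBit (suc x) t ≡ true) e (proj₂ (proj₂ ef))
        hv : ∀ x → testBit (suc x) 0 ≡ false → startA-valid false (pos? x) ≡ true
        hv zero ()
        hv (suc x) _ = refl

    QEdge : Set
    QEdge = ℕ × ℕ × Dir

    SimulatesEdge : QEdge → SimE → Set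
    SimulatesEdge qd sx = (toVertex (qsrc qd) ≡ simSrc sx) × (toVertex (qtgt qd) ≡ simTgt sx)
                        × ((qlab (qsrc qd) , proj₂ (proj₂ qd) , qlab (qtgt qd)) ≡ simLabE sx)

    spec⇒simulatesEdge : ∀ σ v pu pw w u uend qd sx → PathSpec σ v pu pw w u uend sx →
      proj₁ (proj₁ (toVertex (qsrc qd))) ≡ (point σ (u , w) 0 , encV (pathSource σ v pu pw)) →
      proj₁ (proj₁ (toVertex (qtgt qd))) ≡ (point σ (uend , w) 0 , encV (pathTarget σ v pu pw)) →
      (qlab (qsrc qd) , proj₂ (proj₂ qd) , qlab (qtgt qd)) ≡ quadrantEdge σ v pu pw →
      SimulatesEdge qd sx
    spec⇒simulatesEdge σ v pu pw w u uend qd sx (src , tgt , lab) src′ tgt′ lab′ =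
      SimV-≡ _ _ (trans src′ (sym src)) (trans (cong proj₁ (trans lab′ (sym lab))) (sym (simSrc-comm sx))) ,
      SimV-≡ _ _ (trans tgt′ (sym tgt)) (trans (cong (λ z → proj₂ (proj₂ z)) (trans lab′ (sym lab))) (sym (simTgt-comm sx))) ,
      trans lab′ (sym lab)

    simulateEdge : (qd : QEdge) → Σ SimE (SimulatesEdge qd)
    simulateEdge qd@(x , y , goR) = let (sx , spec) = incrementEdge P x y in
      sx , spec⇒simulatesEdge P true (pos? x) (pos? y) y x (suc x) qd sx spec refl refl refl
    simulateEdge qd@(x , y , goL) = let (sx , spec) = decrementEdge P x y in
      sx , spec⇒simulatesEdge P false (pos? x) (pos? y) y (suc x) x qd sx spec refl refl refl
    simulateEdge qd@(x , y , goU) = let (sx , spec) = incrementEdge M y x in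
      sx , spec⇒simulatesEdge M true (pos? y) (pos? x) x y (suc y) qd sx spec refl refl refl
    simulateEdge qd@(x , y , goD) = let (sx , spec) = decrementEdge M y x in
      sx , spec⇒simulatesEdge M false (pos? y) (pos? x) x (suc y) y qd sx spec refl refl refl


module Determinism where

  open Binary
  open Halves
  open LocalRules
  open Characterisation
  open Simulator
  open VertexBijection
  open SimulatedPaths
  open import Data.Nat as N using (zero; suc)
  import Data.Nat.Properties as NP
  open import Data.Integer using (+_)
  open import Data.Bool using (Bool; true; false; not; if_then_else_)
  import Data.Bool.Properties as BP
  open import Data.Product using (_×_; _,_; proj₁; proj₂)
  open import Data.Sum using (_⊎_; inj₁; inj₂)
  open import Data.Empty using (⊥; ⊥-elim)
  open import Relation.Binary.PropositionalEquality
  open import Relation.Nullary using (yes; no)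

  module Uniqueness (η : Lamp → Λ) (h : InΩ η) (h1 : η one ≡ ((true , true) , sea)) where
    open Vertices η h h1
    open Labels η h h1
    open Simulation (cayley η) simulator
    open Paths η h h1

    sameGen : Gen → Gen → Bool
    sameGen x y = codeG x N.≡ᵇ codeG y

    paramsOf : QE → Side × Bool × Bool × Bool
    paramsOf (l1 , goR , l2) = P , true , proj₁ (proj₂ l1) , proj₂ (proj₂ (proj₂ l1))
    paramsOf (l1 , goL , l2) = P , false , proj₁ (proj₂ l2) , proj₂ (proj₂ (proj₂ l2))
    paramsOf (l1 , goU , l2) = M , true , proj₂ (proj₂ (proj₂ l1)) , proj₁ (proj₂ l1)
    paramsOf (l1 , goD , l2) = M , false , proj₂ (proj₂ (proj₂ l2)) , proj₁ (proj₂ l2)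

    paramsOf-quadrantEdge : ∀ σ v pu pw → paramsOf (quadrantEdge σ v pu pw) ≡ (σ , v , pu , pw)
    paramsOf-quadrantEdge P true pu pw = refl
    paramsOf-quadrantEdge P false pu pw = refl
    paramsOf-quadrantEdge M true pu pw = refl
    paramsOf-quadrantEdge M false pu pw = refl

    rebuildStart : (Side × Bool × Bool × Bool) → Gen → Λ → SE
    rebuildStart edgeParams@(σ , _) gen l = if sameGen gen (upA σ) then (edgeParams , startA (proj₁ (proj₁ l)) (proj₂ (proj₁ l))) else (edgeParams , startB (proj₁ (proj₁ l)) (proj₂ (proj₁ l)))

    rebuild : SV → QE → Gen → Λ → SE
    rebuild (seaVertex _ _) q gen l = rebuildStart (paramsOf q) gen l
    rebuild (pathVertex σ v pu pw climbing b1 b2) q gen l =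
      if sameGen gen (upA σ) then ((σ , v , pu , pw) , climbA b1 b2 (proj₁ (proj₁ l)) (proj₂ (proj₁ l)))
      else ((σ , v , pu , pw) , climbB b1 b2 (proj₁ (proj₁ l)) (proj₂ (proj₁ l)))
    rebuild (pathVertex σ v pu pw turning b1 b2) q gen l =
      if arrow l == sea then ((σ , v , pu , pw) , turnEnd b1 b2)
      else ((σ , v , pu , pw) , turnDown b1 b2 (proj₁ (proj₁ l)) (proj₂ (proj₁ l)))
    rebuild (pathVertex σ v pu pw descending b1 b2) q gen l =
      if arrow l == sea then ((σ , v , pu , pw) , descendEnd b1 b2)
      else ((σ , v , pu , pw) , descendB b1 b2 (proj₁ (proj₁ l)) (proj₂ (proj₁ l)))

    quadrantEdgeOf : SE → QE
    quadrantEdgeOf e = proj₁ (proj₂ (labelQE e))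

    NotDirectLabel : Bool × QE × Bool → Set
    NotDirectLabel (i , _ , j) = (i ≡ true) ⊎ (j ≡ true)

    NotDirect : SE → Set
    NotDirect e = NotDirectLabel (labelQE e)

    rebuild-correct : ∀ e → NotDirect e → rebuild (srcS e) (quadrantEdgeOf e) (genOf e) (labelΛ (tgtS e)) ≡ e
    rebuild-correct ((σ , v , pu , pw) , startA b1 b2) ok with startA-valid v pu | ok
    ... | false | inj₁ ()
    ... | false | inj₂ ()
    ... | true | _ = go σ v
      where
      go : ∀ σ v → rebuild (pathSource σ v pu pw) (quadrantEdge σ v pu pw) (upA σ) ((b1 , b2) , run σ v) ≡ ((σ , v , pu , pw) , startA b1 b2)
      go P true = refl
      go P false = refl
      go M true = refl
      go M false = refl
    rebuild-correct ((σ , v , pu , pw) , startB b1 b2) ok with startB-valid σ v pu b1 b2 | ok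
    ... | false | inj₁ ()
    ... | false | inj₂ ()
    ... | true | _ = go σ v
      where
      go : ∀ σ v → rebuild (pathSource σ v pu pw) (quadrantEdge σ v pu pw) (upB σ) ((b1 , b2) , run σ v) ≡ ((σ , v , pu , pw) , startB b1 b2)
      go P true = refl
      go P false = refl
      go M true = refl
      go M false = refl
    rebuild-correct ((P , v , pu , pw) , climbA b1 b2 c1 c2) ok = refl
    rebuild-correct ((M , v , pu , pw) , climbA b1 b2 c1 c2) ok = refl
    rebuild-correct ((P , v , pu , pw) , climbB b1 b2 c1 c2) ok = refl
    rebuild-correct ((M , v , pu , pw) , climbB b1 b2 c1 c2) ok = refl
    rebuild-correct ((P , true , pu , pw) , turnEnd b1 b2) ok = refl
    rebuild-correct ((P , false , pu , pw) , turnEnd b1 b2) ok = refl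
    rebuild-correct ((M , true , pu , pw) , turnEnd b1 b2) ok = refl
    rebuild-correct ((M , false , pu , pw) , turnEnd b1 b2) ok = refl
    rebuild-correct ((P , true , pu , pw) , turnDown b1 b2 c1 c2) ok = refl
    rebuild-correct ((P , false , pu , pw) , turnDown b1 b2 c1 c2) ok = refl
    rebuild-correct ((M , true , pu , pw) , turnDown b1 b2 c1 c2) ok = refl
    rebuild-correct ((M , false , pu , pw) , turnDown b1 b2 c1 c2) ok = refl
    rebuild-correct ((P , true , pu , pw) , descendB b1 b2 c1 c2) ok = refl
    rebuild-correct ((P , false , pu , pw) , descendB b1 b2 c1 c2) ok = refl
    rebuild-correct ((M , true , pu , pw) , descendB b1 b2 c1 c2) ok = refl
    rebuild-correct ((M , false , pu , pw) , descendB b1 b2 c1 c2) ok = refl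
    rebuild-correct ((P , true , pu , pw) , descendEnd b1 b2) ok = refl
    rebuild-correct ((P , false , pu , pw) , descendEnd b1 b2) ok = refl
    rebuild-correct ((M , true , pu , pw) , descendEnd b1 b2) ok = refl
    rebuild-correct ((M , false , pu , pw) , descendEnd b1 b2) ok = refl

    isBranching : SV → Bool
    isBranching (seaVertex _ _) = true
    isBranching (pathVertex _ _ _ _ climbing _ _) = true
    isBranching (pathVertex _ _ _ _ turning _ _) = false
    isBranching (pathVertex _ _ _ _ descending _ _) = false

    descentGen : SV → Gen
    descentGen (pathVertex σ _ _ _ turning _ _) = downA σ
    descentGen (pathVertex σ _ _ _ descending _ _) = downB σ
    descentGen _ = a

    pathSource-branching : ∀ σ v pu pw → isBranching (pathSource σ v pu pw) ≡ true
    pathSource-branching P true pu pw = refl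
    pathSource-branching P false pu pw = refl
    pathSource-branching M true pu pw = refl
    pathSource-branching M false pu pw = refl

    genOf-nonBranching : ∀ e → isBranching (srcS e) ≡ false → genOf e ≡ descentGen (srcS e)
    genOf-nonBranching ((σ , v , pu , pw) , startA _ _) e' with trans (sym (pathSource-branching σ v pu pw)) e'
    ... | ()
    genOf-nonBranching ((σ , v , pu , pw) , startB _ _) e' with trans (sym (pathSource-branching σ v pu pw)) e'
    ... | ()
    genOf-nonBranching ((σ , v , pu , pw) , turnEnd _ _) e' = refl
    genOf-nonBranching ((σ , v , pu , pw) , turnDown _ _ _ _) e' = refl
    genOf-nonBranching ((σ , v , pu , pw) , descendB _ _ _ _) e' = refl
    genOf-nonBranching ((σ , v , pu , pw) , descendEnd _ _) e' = refl

    sideOf : SE → Side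
    sideOf e = proj₁ (paramsOf (quadrantEdgeOf e))
    directionOf : SE → Bool
    directionOf e = proj₁ (proj₂ (paramsOf (quadrantEdgeOf e)))

    genOf-branching : ∀ e → NotDirect e → isBranching (srcS e) ≡ true →
             ((genOf e ≡ upA (sideOf e)) ⊎ (genOf e ≡ upB (sideOf e))) × (arrow (labelΛ (tgtS e)) ≡ run (sideOf e) (directionOf e))
    genOf-branching ((σ , v , pu , pw) , startA b1 b2) ok _ with startA-valid v pu | ok
    ... | false | inj₁ ()
    ... | false | inj₂ ()
    ... | true | _ = go σ v
      where
      go : ∀ σ v → ((upA σ ≡ upA (proj₁ (paramsOf (quadrantEdge σ v pu pw)))) ⊎ (upA σ ≡ upB (proj₁ (paramsOf (quadrantEdge σ v pu pw))))) × (run σ v ≡ run (proj₁ (paramsOf (quadrantEdge σ v pu pw))) (proj₁ (proj₂ (paramsOf (quadrantEdge σ v pu pw)))))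
      go P true = inj₁ refl , refl
      go P false = inj₁ refl , refl
      go M true = inj₁ refl , refl
      go M false = inj₁ refl , refl
    genOf-branching ((σ , v , pu , pw) , startB b1 b2) ok _ with startB-valid σ v pu b1 b2 | ok
    ... | false | inj₁ ()
    ... | false | inj₂ ()
    ... | true | _ = go σ v
      where
      go : ∀ σ v → ((upB σ ≡ upA (proj₁ (paramsOf (quadrantEdge σ v pu pw)))) ⊎ (upB σ ≡ upB (proj₁ (paramsOf (quadrantEdge σ v pu pw))))) × (run σ v ≡ run (proj₁ (paramsOf (quadrantEdge σ v pu pw))) (proj₁ (proj₂ (paramsOf (quadrantEdge σ v pu pw)))))
      go P true = inj₂ refl , refl
      go P false = inj₂ refl , refl
      go M true = inj₂ refl , refl
      go M false = inj₂ refl , refl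
    genOf-branching ((P , true , pu , pw) , climbA _ _ _ _) ok _ = inj₁ refl , refl
    genOf-branching ((P , false , pu , pw) , climbA _ _ _ _) ok _ = inj₁ refl , refl
    genOf-branching ((M , true , pu , pw) , climbA _ _ _ _) ok _ = inj₁ refl , refl
    genOf-branching ((M , false , pu , pw) , climbA _ _ _ _) ok _ = inj₁ refl , refl
    genOf-branching ((P , true , pu , pw) , climbB _ _ _ _) ok _ = inj₂ refl , refl
    genOf-branching ((P , false , pu , pw) , climbB _ _ _ _) ok _ = inj₂ refl , refl
    genOf-branching ((M , true , pu , pw) , climbB _ _ _ _) ok _ = inj₂ refl , refl
    genOf-branching ((M , false , pu , pw) , climbB _ _ _ _) ok _ = inj₂ refl , refl
    genOf-branching (_ , turnEnd _ _) ok ()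
    genOf-branching (_ , turnDown _ _ _ _) ok ()
    genOf-branching (_ , descendB _ _ _ _) ok ()
    genOf-branching (_ , descendEnd _ _) ok ()

    run≢sea : ∀ σ v → run σ v ≡ sea → ⊥
    run≢sea P true ()
    run≢sea P false ()
    run≢sea M true ()
    run≢sea M false ()

    run-offOpposite : ∀ σ v → onSide (opposite σ) (run σ v) ≡ false
    run-offOpposite P true = refl
    run-offOpposite P false = refl
    run-offOpposite M true = refl
    run-offOpposite M false = refl

    run-notOpposite : ∀ σ v c k → arrow (η (point (opposite σ) c k)) ≡ run σ v → ⊥
    run-notOpposite σ v c zero e = run≢sea σ v (trans (sym e) (seaLevel-point (opposite σ) c))
    run-notOpposite σ v c (suc k) e with trans (sym (run-offOpposite σ v)) (trans (cong (onSide (opposite σ)) (sym e)) (arrow-onSide (opposite σ) c k))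
    ... | ()

    notBothRuns : ∀ σ v g → arrow (η (g · upA σ)) ≡ run σ v → arrow (η (g · upB σ)) ≡ run σ v → ⊥
    notBothRuns σ v g f1 f2 with position σ g
    ... | own (u , w) j = BP.not-¬ refl (sym (trans (sym (trans (testBit-flipBit-same j u) (cong not b1))) b2))
      where
      a1 : lowBits v u (suc j) ≡ true
      a1 = predictedArrow-run⁻¹ σ v u j (trans (sym (arrow-predicted σ u w (suc j))) (trans (cong (λ z → arrow (η z)) (sym (point-upA σ (u , w) j))) f1))
      a2 : lowBits v (flipBit u j) (suc j) ≡ true
      a2 = predictedArrow-run⁻¹ σ v (flipBit u j) j (trans (sym (arrow-predicted σ (flipBit u j) w (suc j))) (trans (cong (λ z → arrow (η z)) (sym (point-upB σ (u , w) j))) f2))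
      b1 = lowBits⇒testBit v u (suc j) a1 j NP.≤-refl
      b2 = lowBits⇒testBit v (flipBit u j) (suc j) a2 j NP.≤-refl
    ... | other c k = run-notOpposite σ v c k (trans (cong (λ x → arrow (η x)) (sym step)) f1)
      where
      step : point (opposite σ) c (suc k) · upA σ ≡ point (opposite σ) c k
      step = trans (cong (point (opposite σ) c (suc k) ·_) (upA-opposite σ)) (point-downA (opposite σ) c k)

    simulatorEdge-≡ : ∀ e e' → NotDirect e → NotDirect e' → srcS e ≡ srcS e' → quadrantEdgeOf e ≡ quadrantEdgeOf e' → genOf e ≡ genOf e' → labelΛ (tgtS e) ≡ labelΛ (tgtS e') → e ≡ e'
    simulatorEdge-≡ e e' ok ok' s1 q1 g1 l1 =
      trans (sym (rebuild-correct e ok)) (trans (cong₂ (λ x y → rebuild x (quadrantEdgeOf e) y (labelΛ (tgtS e))) s1 g1)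
        (trans (cong₂ (λ x y → rebuild (srcS e') x (genOf e') y) q1 l1) (rebuild-correct e' ok')))

    sameGenerator : ∀ g gen f gen' f' → srcS (decE f) ≡ srcS (decE f') → quadrantEdgeOf (decE f) ≡ quadrantEdgeOf (decE f') →
                    NotDirect (decE f) → NotDirect (decE f') →
                    (η g , gen , η (g · gen)) ≡ labelΛE (decE f) → (η g , gen' , η (g · gen')) ≡ labelΛE (decE f') →
                    genOf (decE f) ≡ genOf (decE f')
    sameGenerator g gen f gen' f' s1 q1 ok ok' eqA eqA' = go (isBranching (srcS e)) refl
      where
      e = decE f
      e' = decE f'
      RunAt : (Side → Gen) → QE → Set
      RunAt step q = arrow (η (g · step (proj₁ (paramsOf q)))) ≡ run (proj₁ (paramsOf q)) (proj₁ (proj₂ (paramsOf q)))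
      runAt : ∀ {gen} e step → (η g , gen , η (g · gen)) ≡ labelΛE e → genOf e ≡ step (sideOf e) →
              arrow (labelΛ (tgtS e)) ≡ run (sideOf e) (directionOf e) → RunAt step (quadrantEdgeOf e)
      runAt e step eq x reached = trans (cong (λ z → arrow (η (g · z))) (trans (sym x) (sym (cong (λ z → proj₁ (proj₂ z)) eq))))
                                      (trans (cong (λ z → arrow (proj₂ (proj₂ z))) eq) reached)
      go : ∀ b → isBranching (srcS e) ≡ b → genOf e ≡ genOf e'
      go false eb = trans (genOf-nonBranching e eb) (trans (cong descentGen s1) (sym (genOf-nonBranching e' (trans (cong isBranching (sym s1)) eb))))
      go true eb with genOf-branching e ok eb | genOf-branching e' ok' (trans (cong isBranching (sym s1)) eb)
      ... | inj₁ x1 , _ | inj₁ x2 , _ = trans x1 (trans (cong (λ z → upA (proj₁ (paramsOf z))) q1) (sym x2))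
      ... | inj₂ x1 , _ | inj₂ x2 , _ = trans x1 (trans (cong (λ z → upB (proj₁ (paramsOf z))) q1) (sym x2))
      ... | inj₁ x1 , a1 | inj₂ x2 , a2 = ⊥-elim (notBothRuns (sideOf e) (directionOf e) g
            (runAt e upA eqA x1 a1) (subst (RunAt upB) (sym q1) (runAt e' upB eqA' x2 a2)))
      ... | inj₂ x1 , a1 | inj₁ x2 , a2 = ⊥-elim (notBothRuns (sideOf e) (directionOf e) g
            (subst (RunAt upA) (sym q1) (runAt e' upA eqA' x2 a2)) (runAt e upB eqA x1 a1))

    generator-determined : ∀ g gen f gen' f' → srcS (decE f) ≡ srcS (decE f') → quadrantEdgeOf (decE f) ≡ quadrantEdgeOf (decE f') →
                           NotDirect (decE f) → NotDirect (decE f') →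
                           (η g , gen , η (g · gen)) ≡ labelΛE (decE f) → (η g , gen' , η (g · gen')) ≡ labelΛE (decE f') →
                           (gen , f) ≡ (gen' , f')
    generator-determined g gen f gen' f' s1 q1 ok ok' eqA eqA' =
      cong₂ _,_ gen≡gen′ (trans (sym (enc-decE f)) (trans (cong encE (simulatorEdge-≡ (decE f) (decE f') ok ok' s1 q1 same target)) (enc-decE f')))
      where
      same = sameGenerator g gen f gen' f' s1 q1 ok ok' eqA eqA'
      gen≡gen′ : gen ≡ gen'
      gen≡gen′ = trans (cong (λ z → proj₁ (proj₂ z)) eqA) (trans same (sym (cong (λ z → proj₁ (proj₂ z)) eqA')))
      target : labelΛ (tgtS (decE f)) ≡ labelΛ (tgtS (decE f'))
      target = trans (sym (cong (λ z → proj₂ (proj₂ z)) eqA)) (trans (cong (λ z → η (g · z)) gen≡gen′) (cong (λ z → proj₂ (proj₂ z)) eqA'))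

    encV-injective : ∀ {x y : SV} → encV x ≡ encV y → x ≡ y
    encV-injective {x} {y} e = trans (sym (dec-encV x)) (trans (cong decV e) (dec-encV y))

    fibreEdge-determined : ∀ (p p' : FE) → fsrc p ≡ fsrc p' → quadrantEdgeOf (decE (proj₂ (proj₁ p))) ≡ quadrantEdgeOf (decE (proj₂ (proj₁ p'))) →
            NotDirect (decE (proj₂ (proj₁ p))) → NotDirect (decE (proj₂ (proj₁ p'))) → p ≡ p'
    fibreEdge-determined (((g , gen) , f) , eqA) (((g' , gen') , f') , eqA') r q1 ok ok' with cong (λ z → proj₁ (proj₁ z)) r
    ... | refl = FE-≡ _ _ (cong (λ z → (g , proj₁ z) , proj₂ z) dc)
      where
      s1 : srcS (decE f) ≡ srcS (decE f')
      s1 = encV-injective (cong (λ z → proj₂ (proj₁ z)) r)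
      dc = generator-determined g gen f gen' f' s1 q1 ok ok' eqA eqA'

    stop-≡ : ∀ {c} (p p' : FE) → p ≡ p' → ∀ e e' (q : fsrc p ≡ fsrc p') → subst (Tail c) q (stop p e) ≡ stop p' e'
    stop-≡ p .p refl e e' q rewrite uipFV q refl | uipLE e e' = refl

    loop-≡ : ∀ {c} (p p' : FE) → p ≡ p' → ∀ e e' (t : Tail c (ftgt p)) (t' : Tail c (ftgt p')) →
              (∀ (q' : ftgt p ≡ ftgt p') → subst (Tail c) q' t ≡ t') →
              (q : fsrc p ≡ fsrc p') → subst (Tail c) q (loop p e t) ≡ loop p' e' t'
    loop-≡ p .p refl e e' t t' ih q rewrite uipFV q refl | uipLE e e' = cong (loop p e') (ih refl)

    Tail-unique : ∀ {c x x'} (t : Tail c x) (t' : Tail c x') (q : x ≡ x') → subst (Tail c) q t ≡ t'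
    Tail-unique (stop p e) (stop p' e') q =
      stop-≡ p p' (fibreEdge-determined p p' q (trans (cong (λ z → proj₁ (proj₂ z)) e) (sym (cong (λ z → proj₁ (proj₂ z)) e')))
                     (inj₁ (cong proj₁ e)) (inj₁ (cong proj₁ e'))) e e' q
    Tail-unique (stop p e) (loop p' e' t') q with fibreEdge-determined p p' q (trans (cong (λ z → proj₁ (proj₂ z)) e) (sym (cong (λ z → proj₁ (proj₂ z)) e')))
                     (inj₁ (cong proj₁ e)) (inj₁ (cong proj₁ e'))
    ... | refl with trans (sym e) e'
    ... | ()
    Tail-unique (loop p e t) (stop p' e') q with fibreEdge-determined p p' q (trans (cong (λ z → proj₁ (proj₂ z)) e) (sym (cong (λ z → proj₁ (proj₂ z)) e')))
                     (inj₁ (cong proj₁ e)) (inj₁ (cong proj₁ e'))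
    ... | refl with trans (sym e) e'
    ... | ()
    Tail-unique (loop p e t) (loop p' e' t') q =
      loop-≡ p p' (fibreEdge-determined p p' q (trans (cong (λ z → proj₁ (proj₂ z)) e) (sym (cong (λ z → proj₁ (proj₂ z)) e')))
                     (inj₁ (cong proj₁ e)) (inj₁ (cong proj₁ e'))) e e' t t' (Tail-unique t t') q

    invalidStart-sea : ∀ e → proj₁ (labelQE e) ≡ false → proj₂ (proj₂ (labelQE e)) ≡ false →
                       (arrow (labelΛ (srcS e)) ≡ sea) × (arrow (labelΛ (tgtS e)) ≡ sea)
    invalidStart-sea ((σ , v , pu , pw) , startA _ _) _ invalid rewrite invalid = pathSource-sea σ v pu pw , pathTarget-sea σ v pu pw
    invalidStart-sea ((σ , v , pu , pw) , startB _ _) _ invalid rewrite invalid = pathSource-sea σ v pu pw , pathTarget-sea σ v pu pw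
    invalidStart-sea (_ , climbA _ _ _ _) () _
    invalidStart-sea (_ , climbB _ _ _ _) () _
    invalidStart-sea (_ , turnEnd _ _) () _
    invalidStart-sea (_ , turnDown _ _ _ _) () _
    invalidStart-sea (_ , descendB _ _ _ _) () _
    invalidStart-sea (_ , descendEnd _ _) () _

    step-leaves-seaLevel : ∀ s gen → proj₂ ((s , + 0) · gen) ≡ + 0 → ⊥
    step-leaves-seaLevel s a ()
    step-leaves-seaLevel s a⁻¹ ()
    step-leaves-seaLevel s b ()
    step-leaves-seaLevel s b⁻¹ ()

    no-direct-edge : ∀ c (p : FE) → labE p ≡ (false , c , false) → ⊥
    no-direct-edge c (((g , gen) , f) , eqA) eq = step-leaves-seaLevel (proj₁ g) gen (trans (cong (λ z → proj₂ (z · gen)) g0) n1)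
      where
      ik = invalidStart-sea (decE f) (cong proj₁ eq) (cong (λ z → proj₂ (proj₂ z)) eq)
      n0 : proj₂ g ≡ + 0
      n0 = sea⇒level0 (proj₁ g) (proj₂ g) (trans (cong (λ z → arrow (proj₁ z)) eqA) (proj₁ ik))
      g0 : (proj₁ g , + 0) ≡ g
      g0 = cong (proj₁ g ,_) (sym n0)
      n1 : proj₂ (g · gen) ≡ + 0
      n1 = sea⇒level0 (proj₁ (g · gen)) (proj₂ (g · gen)) (trans (cong (λ z → arrow (proj₂ (proj₂ z))) eqA) (proj₂ ik))

    via-≡ : ∀ c (p p' : FE) → p ≡ p' → ∀ e e' (t : Tail c (ftgt p)) (t' : Tail c (ftgt p')) →
             (∀ (q : ftgt p ≡ ftgt p') → subst (Tail c) q t ≡ t') → via c p e t ≡ via c p' e' t'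
    via-≡ c p .p refl e e' t t' ih rewrite uipLE e e' = cong (via c p e') (ih refl)

    SimE-unique : ∀ (sx sx' : SimE) → proj₁ (simSrc sx) ≡ proj₁ (simSrc sx') → simLabE sx ≡ simLabE sx' → sx ≡ sx'
    SimE-unique (direct c p e) _ _ _ = ⊥-elim (no-direct-edge c p e)
    SimE-unique (via c p e t) (direct c' p' e') _ _ = ⊥-elim (no-direct-edge c' p' e')
    SimE-unique (via c p e t) (via .c p' e' t') r refl =
      via-≡ c p p' (fibreEdge-determined p p' r (trans (cong (λ z → proj₁ (proj₂ z)) e) (sym (cong (λ z → proj₁ (proj₂ z)) e')))
                       (inj₂ (cong (λ z → proj₂ (proj₂ z)) e)) (inj₂ (cong (λ z → proj₂ (proj₂ z)) e'))) e e' t t' (Tail-unique t t')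


module EdgeBijection where

  open Binary
  open Halves
  open LocalRules
  open Characterisation
  open Simulator
  open VertexBijection
  open SimulatedPaths
  open Determinism
  open import Data.Nat as N using (ℕ; zero; suc; z≤n; s≤s)
  open import Data.Integer using (+_)
  open import Data.Bool using (true; false; not)
  import Data.Bool.Properties as BP
  open import Data.Product using (_×_; _,_; proj₁; proj₂)
  open import Data.Empty using (⊥-elim)
  open import Relation.Binary.PropositionalEquality
  open import Function.Bundles using (_↔_; mk↔ₛ′)

  module Edges (η : Lamp → Λ) (h : InΩ η) (h1 : η one ≡ ((true , true) , sea)) where
    open Vertices η h h1
    open Labels η h h1
    open Simulation (cayley η) simulator
    open Paths η h h1
    open Uniqueness η h h1

    -- Quadrant edges are named by their lower endpoint, so the leftward or
    -- downward edge leaving the point coded by s is indexed by a predecessor.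
    quadrantEdgeAt : ℕ → Dir → QEdge
    quadrantEdgeAt s goR = evens s , odds s , goR
    quadrantEdgeAt s goL = N.pred (evens s) , odds s , goL
    quadrantEdgeAt s goU = evens s , odds s , goU
    quadrantEdgeAt s goD = evens s , N.pred (odds s) , goD

    fromEdge : SimE → QEdge
    fromEdge sx = quadrantEdgeAt (proj₁ (proj₁ (proj₁ (proj₁ (simSrc sx))))) (proj₁ (proj₂ (simLabE sx)))

    toEdge : QEdge → SimE
    toEdge qd = proj₁ (simulateEdge qd)

    fromEdge-toEdge : ∀ qd → fromEdge (toEdge qd) ≡ qd
    fromEdge-toEdge qd = trans (cong₂ quadrantEdgeAt lam dir) (fin qd)
      where
      sp = proj₂ (simulateEdge qd)
      lam : proj₁ (proj₁ (proj₁ (proj₁ (simSrc (toEdge qd))))) ≡ interleave (proj₁ (qsrc qd)) (proj₂ (qsrc qd))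
      lam = cong (λ z → proj₁ (proj₁ (proj₁ (proj₁ z)))) (sym (proj₁ sp))
      dir : proj₁ (proj₂ (simLabE (toEdge qd))) ≡ proj₂ (proj₂ qd)
      dir = cong (λ z → proj₁ (proj₂ z)) (sym (proj₂ (proj₂ sp)))
      fin : ∀ qd → quadrantEdgeAt (interleave (proj₁ (qsrc qd)) (proj₂ (qsrc qd))) (proj₂ (proj₂ qd)) ≡ qd
      fin (x , y , goR) = cong₂ (λ p q → p , q , goR) (evens-interleave x y) (odds-interleave x y)
      fin (x , y , goL) = cong₂ (λ p q → N.pred p , q , goL) (evens-interleave (suc x) y) (odds-interleave (suc x) y)
      fin (x , y , goU) = cong₂ (λ p q → p , q , goU) (evens-interleave x y) (odds-interleave x y)
      fin (x , y , goD) = cong₂ (λ p q → p , N.pred q , goD) (evens-interleave x (suc y)) (odds-interleave x (suc y))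

    η-seaVertex : ∀ s → η (s , + 0) ≡ labelΛ (seaVertex (pos? (evens s)) (pos? (odds s)))
    η-seaVertex s = subst (λ z → η (z , + 0) ≡ labelΛ (seaVertex (pos? (evens s)) (pos? (odds s)))) (interleave-split s) (η-seaLevel (evens s) (odds s))

    seaVertex-injective : ∀ {x y x' y'} → labelΛ (seaVertex x y) ≡ labelΛ (seaVertex x' y') → (x ≡ x') × (y ≡ y')
    seaVertex-injective e = BP.not-injective (cong (λ l → proj₁ (proj₁ l)) e) , BP.not-injective (cong (λ l → proj₂ (proj₁ l)) e)

    suc-pred : ∀ {u} → pos? u ≡ true → suc (N.pred u) ≡ u
    suc-pred {suc u} _ = refl

    sea-upA : ∀ σ s → (s , + 0) · upA σ ≡ point σ (decode σ s) 1
    sea-upA σ s = trans (cong (_· upA σ) (sym (point-decode-origin σ s))) (point-upA σ (decode σ s) 0)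

    sea-upB : ∀ σ s → (s , + 0) · upB σ ≡ point σ (flipAt (decode σ s) 0) 1
    sea-upB σ s = trans (cong (_· upB σ) (sym (point-decode-origin σ s))) (point-upB σ (decode σ s) 0)

    decrement-startA-pred : ∀ σ u w → arrow (η (point σ (u , w) 1)) ≡ zeroRun σ → pos? u ≡ true → pos? (N.pred u) ≡ true
    decrement-startA-pred σ (suc zero) w ea pu with lowBits⇒testBit false 1 1 (predictedArrow-run⁻¹ σ false 1 0 (trans (sym (arrow-predicted σ 1 w 1)) ea)) 0 (s≤s z≤n)
    ... | ()
    decrement-startA-pred σ (suc (suc u)) w ea pu = refl

    decrement-startB-pred : ∀ σ u w pu → arrow (η (point σ (flipBit u 0 , w) 1)) ≡ zeroRun σ → pos? u ≡ true →
            pu ≡ not (mark σ (η (point σ (flipBit u 0 , w) 1))) → pu ≡ pos? (N.pred u)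
    decrement-startB-pred σ (suc u') w pu ea _ ep = trans ep (trans (cong not (trans (cong (λ z → mark σ (η (point σ (z , w) 1))) (suc-flipBit-0 u' b0)) (mark-level1 σ u' w bu'))) (BP.not-involutive _))
      where
      bf : testBit (flipBit (suc u') 0) 0 ≡ false
      bf = lowBits⇒testBit false (flipBit (suc u') 0) 1 (predictedArrow-run⁻¹ σ false (flipBit (suc u') 0) 0 (trans (sym (arrow-predicted σ (flipBit (suc u') 0) w 1)) ea)) 0 (s≤s z≤n)
      b0 : testBit (suc u') 0 ≡ true
      b0 = trans (sym (BP.not-involutive _)) (trans (cong not (sym (trans (sym bf) (testBit-flipBit-same 0 (suc u'))))) refl)
      bu' : testBit u' 0 ≡ false
      bu' = trans (sym (BP.not-involutive (isOdd u'))) (cong not b0)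

    StartsAt : QE → Lamp → SV → Set
    StartsAt c g sv = (proj₁ (proj₁ (toVertex (qsrc (quadrantEdgeAt (proj₁ g) (proj₁ (proj₂ c)))))) ≡ (g , encV sv)) ×
                  ((qlab (qsrc (quadrantEdgeAt (proj₁ g) (proj₁ (proj₂ c)))) , proj₂ (proj₂ (quadrantEdgeAt (proj₁ g) (proj₁ (proj₂ c)))) ,
                    qlab (qtgt (quadrantEdgeAt (proj₁ g) (proj₁ (proj₂ c))))) ≡ c)

    startsAt-increment : ∀ σ pu pw s n → η (s , n) ≡ labelΛ (pathSource σ true pu pw) → StartsAt (quadrantEdge σ true pu pw) (s , n) (pathSource σ true pu pw)
    startsAt-increment P pu pw s n hs with seaVertex-injective (trans (sym (η-seaVertex s)) (subst (λ z → η (s , z) ≡ labelΛ (seaVertex pu pw)) n0 hs))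
      where
      n0 = sea⇒level0 s n (cong arrow hs)
    ... | refl , refl = cong₂ _,_ (cong₂ _,_ (interleave-split s) (sym (sea⇒level0 s n (cong arrow hs)))) refl , refl
    startsAt-increment M pu pw s n hs with seaVertex-injective (trans (sym (η-seaVertex s)) (subst (λ z → η (s , z) ≡ labelΛ (seaVertex pw pu)) n0 hs))
      where
      n0 = sea⇒level0 s n (cong arrow hs)
    ... | refl , refl = cong₂ _,_ (cong₂ _,_ (interleave-split s) (sym (sea⇒level0 s n (cong arrow hs)))) refl , refl

    startsAt-decrement : ∀ σ pu pw s n → η (s , n) ≡ labelΛ (pathSource σ false pu pw) → pu ≡ pos? (N.pred (proj₁ (decode σ s))) →
               StartsAt (quadrantEdge σ false pu pw) (s , n) (pathSource σ false pu pw)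
    startsAt-decrement P pu pw s n hs refl with seaVertex-injective (trans (sym (η-seaVertex s)) (subst (λ z → η (s , z) ≡ labelΛ (seaVertex true pw)) n0 hs))
      where
      n0 = sea⇒level0 s n (cong arrow hs)
    ... | e1 , refl = cong₂ _,_ (cong₂ _,_ (trans (cong (λ z → interleave z (odds s)) (suc-pred e1)) (interleave-split s)) (sym (sea⇒level0 s n (cong arrow hs)))) refl , refl
    startsAt-decrement M pu pw s n hs refl with seaVertex-injective (trans (sym (η-seaVertex s)) (subst (λ z → η (s , z) ≡ labelΛ (seaVertex pw true)) n0 hs))
      where
      n0 = sea⇒level0 s n (cong arrow hs)
    ... | refl , e2 = cong₂ _,_ (cong₂ _,_ (trans (cong (interleave (evens s)) (suc-pred e2)) (interleave-split s)) (sym (sea⇒level0 s n (cong arrow hs)))) refl , refl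

    decrement-source-positive : ∀ σ pu pw s n → η (s , n) ≡ labelΛ (pathSource σ false pu pw) → pos? (proj₁ (decode σ s)) ≡ true
    decrement-source-positive P pu pw s n hs = proj₁ (seaVertex-injective (trans (sym (η-seaVertex s)) (subst (λ z → η (s , z) ≡ labelΛ (seaVertex true pw)) (sea⇒level0 s n (cong arrow hs)) hs)))
    decrement-source-positive M pu pw s n hs = proj₂ (seaVertex-injective (trans (sym (η-seaVertex s)) (subst (λ z → η (s , z) ≡ labelΛ (seaVertex pw true)) (sea⇒level0 s n (cong arrow hs)) hs)))

    startsAt-decrementA : ∀ σ pw s n gen b1 b2 → η (s , n) ≡ labelΛ (pathSource σ false true pw) → gen ≡ upA σ →
                          η ((s , n) · gen) ≡ ((b1 , b2) , zeroRun σ) →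
                          StartsAt (quadrantEdge σ false true pw) (s , n) (pathSource σ false true pw)
    startsAt-decrementA σ pw s n gen b1 b2 hs gg tl =
      startsAt-decrement σ true pw s n hs (sym (decrement-startA-pred σ (proj₁ (decode σ s)) (proj₂ (decode σ s)) ar (decrement-source-positive σ true pw s n hs)))
      where
      n0 = sea⇒level0 s n (trans (cong arrow hs) (pathSource-sea σ false true pw))
      ar : arrow (η (point σ (decode σ s) 1)) ≡ zeroRun σ
      ar = trans (cong (λ z → arrow (η z)) (sym (trans (cong₂ (λ x y → (s , x) · y) n0 gg) (sea-upA σ s)))) (cong arrow tl)

    startsAt-decrementB : ∀ σ pu pw s n gen b1 b2 → η (s , n) ≡ labelΛ (pathSource σ false pu pw) → gen ≡ upB σ →
                          η ((s , n) · gen) ≡ ((b1 , b2) , zeroRun σ) → eqB pu (not (markOf σ b1 b2)) ≡ true →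
                          StartsAt (quadrantEdge σ false pu pw) (s , n) (pathSource σ false pu pw)
    startsAt-decrementB σ pu pw s n gen b1 b2 hs gg tl valid =
      startsAt-decrement σ pu pw s n hs (decrement-startB-pred σ (proj₁ (decode σ s)) (proj₂ (decode σ s)) pu ar (decrement-source-positive σ pu pw s n hs) pe)
      where
      n0 = sea⇒level0 s n (trans (cong arrow hs) (pathSource-sea σ false pu pw))
      gq : (s , n) · gen ≡ point σ (flipAt (decode σ s) 0) 1
      gq = trans (cong₂ (λ x y → (s , x) · y) n0 gg) (sea-upB σ s)
      ar : arrow (η (point σ (flipBit (proj₁ (decode σ s)) 0 , proj₂ (decode σ s)) 1)) ≡ zeroRun σ
      ar = trans (cong (λ z → arrow (η z)) (sym gq)) (cong arrow tl)
      pe : pu ≡ not (mark σ (η (point σ (flipBit (proj₁ (decode σ s)) 0 , proj₂ (decode σ s)) 1)))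
      pe = trans (eqB-sound valid) (cong not (trans (sym (cong (λ l → markOf σ (proj₁ (proj₁ l)) (proj₂ (proj₁ l))) (trans (cong η (sym gq)) tl))) (markOf-mark σ _)))

    startsAt : ∀ c g gen e0 → (η g , gen , η (g · gen)) ≡ labelΛE e0 → labelQE e0 ≡ (false , c , true) → StartsAt c g (srcS e0)
    startsAt c (s , n) gen ((σ , true , pu , pw) , startA b1 b2) eqA e =
      subst (λ c → StartsAt c (s , n) (pathSource σ true pu pw)) (cong (λ z → proj₁ (proj₂ z)) e) (startsAt-increment σ pu pw s n (cong proj₁ eqA))
    startsAt c (s , n) gen ((σ , true , pu , pw) , startB b1 b2) eqA e =
      subst (λ c → StartsAt c (s , n) (pathSource σ true pu pw)) (cong (λ z → proj₁ (proj₂ z)) e) (startsAt-increment σ pu pw s n (cong proj₁ eqA))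
    startsAt c (s , n) gen ((σ , false , pu , pw) , startA b1 b2) eqA e with cong (λ z → proj₂ (proj₂ z)) e
    ... | refl = subst (λ c → StartsAt c (s , n) (pathSource σ false true pw)) (cong (λ z → proj₁ (proj₂ z)) e)
                   (startsAt-decrementA σ pw s n gen b1 b2 (cong proj₁ eqA) (cong (λ z → proj₁ (proj₂ z)) eqA) (cong (λ z → proj₂ (proj₂ z)) eqA))
    startsAt c (s , n) gen ((σ , false , pu , pw) , startB b1 b2) eqA e with eqB pu (not (markOf σ b1 b2)) in valid | cong (λ z → proj₂ (proj₂ z)) e
    ... | true | refl = subst (λ c → StartsAt c (s , n) (pathSource σ false pu pw)) (cong (λ z → proj₁ (proj₂ z)) e)
                          (startsAt-decrementB σ pu pw s n gen b1 b2 (cong proj₁ eqA) (cong (λ z → proj₁ (proj₂ z)) eqA)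
                            (cong (λ z → proj₂ (proj₂ z)) eqA) valid)
    startsAt c g gen (_ , climbA _ _ _ _) eqA ()
    startsAt c g gen (_ , climbB _ _ _ _) eqA ()
    startsAt c g gen (_ , turnEnd _ _) eqA ()
    startsAt c g gen (_ , turnDown _ _ _ _) eqA ()
    startsAt c g gen (_ , descendB _ _ _ _) eqA ()
    startsAt c g gen (_ , descendEnd _ _) eqA ()

    toEdge-fromEdge : ∀ sx → toEdge (fromEdge sx) ≡ sx
    toEdge-fromEdge (direct c p e) = ⊥-elim (no-direct-edge c p e)
    toEdge-fromEdge sx@(via c p@(((g , gen) , f) , eqA) e t) = SimE-unique (toEdge qd) sx srcEq labEq
      where
      A = startsAt c g gen (decE f) eqA e
      qd = fromEdge sx
      sp = proj₂ (simulateEdge qd)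
      srcEq : proj₁ (simSrc (toEdge qd)) ≡ fsrc p
      srcEq = trans (cong proj₁ (sym (proj₁ sp))) (FV-≡ _ _ (proj₁ A))
      labEq : simLabE (toEdge qd) ≡ c
      labEq = trans (sym (proj₂ (proj₂ sp))) (proj₂ A)

    ebij : QEdge ↔ SimE
    ebij = mk↔ₛ′ toEdge fromEdge toEdge-fromEdge fromEdge-toEdge

    quadrant≅simulation : LIso Quadrant (Defs._⋊_ (cayley η) simulator)
    quadrant≅simulation = record
      { vbij = vbij
      ; ebij = ebij
      ; src-pres = λ qd → proj₁ (proj₂ (simulateEdge qd))
      ; tgt-pres = λ qd → proj₁ (proj₂ (proj₂ (simulateEdge qd)))
      ; vlab-pres = λ _ → refl
      ; elab-pres = λ qd → proj₂ (proj₂ (proj₂ (simulateEdge qd)))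
      }



proposition6p10 : (η : Lamp → Λ) → InΩ η → η one ≡ ((true , true) , sea) →
    Simulates (cayley η) Quadrant
proposition6p10 η h h1 = Simulator.simulator , EdgeBijection.Edges.quadrant≅simulation η h h1
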